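{- Let $A=(a_{kl})$ be a real skew-symmetric $n\times n$ matrix, and let $1\le i<j\le n$ with $a_{ij}\neq 0$. Form the $n\times 2n$ matrix $(A,\ I_n)$, interchange the $i$-th column of $A$ with the $i$-th column of $I_n$ and the $j$-th column of $A$ with the $j$-th column of $I_n$, and then perform row operations to bring the resulting matrix to the form $(B,\ I_n)$. Let $C$ be the matrix obtained from $B$ by multiplying row $k$ and column $k$ by $-1$ for every $k$ with $i\le k<j$. Then for every $S\subseteq\{1,\ldots,n\}$, $$C_S = A_{S\,\Delta\,\{i,j\}}/a_{ij}.$$
   Context: For a skew-symmetric $2m\times 2m$ matrix $(a_{pq})_{1\le p,q\le 2m}$, the Pfaffian is $\mathrm{Pf}=\sum_{\sigma\in S'_{2m}}\mathrm{sign}(\sigma)\prod_{t=1}^m a_{\sigma(2t-1)\sigma(2t)}$, where $S'_{2m}=\{\sigma\in S_{2m}: \sigma(2t-1)=\min_{2t-1\le r\le 2m}\sigma(r)\text{ for }1\le t\le m\}$; the Pfaffian of the empty matrix is $1$, and the Pfaffian of a skew-symmetric matrix of odd size is $0$. For a skew-symmetric matrix $X$ and $S\subseteq\{1,\ldots,n\}$, $X_S$ denotes the Pfaffian of the principal submatrix of $X$ with rows and columns indexed by $S$ (in increasing order). $\Delta$ denotes symmetric difference. -}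

module Defs where

open import Level using (Level; _⊔_) renaming (suc to lsuc)
open import Data.Bool using (Bool; true; false; if_then_else_; _∧_; _xor_; not)
open import Data.Nat as ℕ using (ℕ; zero; suc)
open import Data.Fin as Fin using (Fin; zero; suc; splitAt; toℕ)
open import Data.Fin.Subset using (Subset)
open import Data.Vec as Vec using (Vec)
open import Data.List as List using (List; []; _∷_; filterᵇ; concatMap; map; length; allFin)
open import Data.Sum using (_⊎_; inj₁; inj₂; [_,_])
open import Relation.Nullary using (¬_; does)
open import Relation.Binary.PropositionalEquality using (_≡_)
open import Algebra.Bundles using (CommutativeRing)

record Field c ℓ : Set (lsuc (c ⊔ ℓ)) where
  field
    commutativeRing : CommutativeRing c ℓ
  open CommutativeRing commutativeRing public
  field
    0≉1     : ¬ (0# ≈ 1#)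
    inv     : (x : Carrier) → ¬ (x ≈ 0#) → Carrier
    inv-law : ∀ x (nz : ¬ (x ≈ 0#)) → x * inv x nz ≈ 1#

-- all permutations (as words σ(1) … σ(k)) of a list
insertEverywhere : ∀ {a} {A : Set a} → A → List A → List (List A)
insertEverywhere x []       = (x ∷ []) ∷ []
insertEverywhere x (y ∷ ys) = (x ∷ y ∷ ys) ∷ map (y ∷_) (insertEverywhere x ys)

permutations : ∀ {a} {A : Set a} → List A → List (List A)
permutations []       = [] ∷ []
permutations (x ∷ xs) = concatMap (insertEverywhere x) (permutations xs)

_<ᵇ_ : ∀ {m} → Fin m → Fin m → Bool
x <ᵇ y = toℕ x ℕ.<ᵇ toℕ y

_≤ᵇ_ : ∀ {m} → Fin m → Fin m → Bool
x ≤ᵇ y = toℕ x ℕ.≤ᵇ toℕ y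

_=ᵇ_ : ∀ {m} → Fin m → Fin m → Bool
x =ᵇ y = does (x Fin.≟ y)

≤all : ∀ {m} → Fin m → List (Fin m) → Bool
≤all x []       = true
≤all x (y ∷ ys) = (x ≤ᵇ y) ∧ ≤all x ys

-- membership of S'_{2m}: σ(2t-1) = min_{r ≥ 2t-1} σ(r) for all t
inS' : ∀ {m} → List (Fin m) → Bool
inS' []           = true
inS' (x ∷ [])     = true
inS' (x ∷ y ∷ ys) = ≤all x (y ∷ ys) ∧ inS' ys

countGreater : ∀ {m} → Fin m → List (Fin m) → ℕ
countGreater x []       = 0
countGreater x (y ∷ ys) = (if y <ᵇ x then 1 else 0) ℕ.+ countGreater x ys

inversions : ∀ {m} → List (Fin m) → ℕ
inversions []       = 0
inversions (x ∷ xs) = countGreater x xs ℕ.+ inversions xs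

isEven : ℕ → Bool
isEven zero    = true
isEven (suc n) = not (isEven n)

module WithField {c ℓ} (F : Field c ℓ) where
  open Field F using (Carrier; _≈_; _+_; _*_; -_; 0#; 1#)

  -- n × m matrices with entries in F, indexed from 0
  Mat : ℕ → ℕ → Set c
  Mat n m = Fin n → Fin m → Carrier

  _≈ₘ_ : ∀ {n m} → Mat n m → Mat n m → Set ℓ
  M ≈ₘ N = ∀ r s → M r s ≈ N r s

  sumF : ∀ {k} → (Fin k → Carrier) → Carrier
  sumF {zero}  f = 0#
  sumF {suc k} f = f zero + sumF (λ t → f (suc t))

  _⊗_ : ∀ {n k m} → Mat n k → Mat k m → Mat n m
  (M ⊗ N) r s = sumF (λ t → M r t * N t s)

  I : ∀ {n} → Mat n n
  I r s = if r =ᵇ s then 1# else 0#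

  Invertible : ∀ {n} → Mat n n → Set (c ⊔ ℓ)
  Invertible {n} E = Σ' (Mat n n) (λ E' → (E' ⊗ E) ≈ₘ I × (E ⊗ E') ≈ₘ I)
    where
      open import Data.Product using (_×_) renaming (Σ to Σ')

  -- skew-symmetric: Aᵀ = -A with zero diagonal (automatic over ℝ)
  SkewSymmetric : ∀ {n} → Mat n n → Set ℓ
  SkewSymmetric A = (∀ k l → A k l ≈ - A l k) × (∀ k → A k k ≈ 0#)
    where open import Data.Product using (_×_)

  signOf : ℕ → Carrier
  signOf k = if isEven k then 1# else - 1#

  pairProduct : ∀ {m} → Mat m m → List (Fin m) → Carrier
  pairProduct Y []           = 1#
  pairProduct Y (x ∷ [])     = 1#
  pairProduct Y (x ∷ y ∷ ys) = Y x y * pairProduct Y ys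

  sumL : List Carrier → Carrier
  sumL = List.foldr _+_ 0#

  Pf : ∀ {m} → Mat m m → Carrier
  Pf {m} Y =
    if isEven m
    then sumL (map (λ σ → signOf (inversions σ) * pairProduct Y σ)
                   (filterᵇ inS' (permutations (allFin m))))
    else 0#

  elems : ∀ {n} → Subset n → List (Fin n)
  elems {n} S = filterᵇ (λ k → Vec.lookup S k) (allFin n)

  PfSub : ∀ {n} → Mat n n → Subset n → Carrier
  PfSub X S = Pf (λ p q → X (List.lookup (elems S) p) (List.lookup (elems S) q))

  _Δ_ : ∀ {n} → Subset n → Subset n → Subset n
  S Δ T = Vec.zipWith _xor_ S T

  pair : ∀ {n} → Fin n → Fin n → Subset n
  pair {n} i j = Vec.tabulate (λ k → does (k Fin.≟ i) Data.Bool.∨ does (k Fin.≟ j))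
    where import Data.Bool

  augment : ∀ {n} → Mat n n → Mat n n → Mat n (n ℕ.+ n)
  augment {n} L R r s = [ R' , R'' ] (splitAt n s)
    where R'  = λ k → L r k
          R'' = λ k → R r k

  swapCols : ∀ {n} → Fin n → Fin n → Fin (n ℕ.+ n) → Fin (n ℕ.+ n)
  swapCols {n} i j s with splitAt n s
  ... | inj₁ k = if (k =ᵇ i) Data.Bool.∨ (k =ᵇ j) then n Fin.↑ʳ k else s
    where import Data.Bool
  ... | inj₂ k = if (k =ᵇ i) Data.Bool.∨ (k =ᵇ j) then k Fin.↑ˡ n else s
    where import Data.Bool

  swapped : ∀ {n} → Mat n n → Fin n → Fin n → Mat n (n ℕ.+ n)
  swapped A i j r s = augment A I r (swapCols i j s)

  flipSign : ∀ {n} → Fin n → Fin n → Fin n → Carrier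
  flipSign i j k = if (i ≤ᵇ k) ∧ (k <ᵇ j) then - 1# else 1#

  flipRC : ∀ {n} → Fin n → Fin n → Mat n n → Mat n n
  flipRC i j B k l = flipSign i j k * (flipSign i j l * B k l)

-- Row reduction computes B in closed form: with γ = 1 / a_ij its pivot block is [[0, -γ], [γ, 0]],
-- its pivot rows are -γ times row j and γ times row i of A, and off the pivots it is the Schur
-- complement a_kl + (a_ki a_jl - a_kj a_il) γ; pivoting this matrix on the same entry gives A back.
-- Both Pfaffians are evaluated by expansion along the first index.  Adding multiples of the pivot
-- rows and columns to the other ones does not change a Pfaffian, so on a set containing both
-- pivots the Pfaffian of A is a_ij times that of the Schur complement on the rest, and on a set
-- containing one pivot it is the expansion along that pivot's row with Schur complement minors.
-- Matching the four cases i, j ∈ S or ∉ S, what is left is sign bookkeeping: the signs of moving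
-- the pivots to the front are cancelled by negating the rows and columns i ≤ k < j.
module Submission where

open import Defs
open import Data.Nat using (ℕ)
open import Data.Fin using (Fin; _<_)
open import Data.Fin.Subset using (Subset)
open import Relation.Nullary using (¬_)
open import Algebra.Bundles using (CommutativeRing)

-- Ring normalisation with integer coefficients, so that cancellations such as x + - x ≈ 0# are
-- found in an arbitrary commutative ring.
module IntegerCoefficientSolver {c ℓ} (R : CommutativeRing c ℓ) where
  open import Data.Maybe using (Maybe; just; nothing)
  open import Data.Nat as ℕ using (zero; suc)
  open import Data.Integer as ℤ using (ℤ; +_; -[1+_]; _⊖_)
  import Data.Integer.Properties as ℤ
  open import Data.Sign as Sign using (Sign)
  open import Relation.Nullary using (yes; no)
  import Relation.Binary.PropositionalEquality as P
  open import Algebra.Solver.Ring.AlmostCommutativeRing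
  open CommutativeRing R
  open import Algebra.Properties.Semiring.Mult.TCOptimised semiring
  open import Algebra.Properties.Ring ring
    using (-‿involutive; -0#≈0#; -‿distribˡ-*; -‿distribʳ-*; -‿+-comm)
  open import Relation.Binary.Reasoning.Setoid setoid

  ⟦_⟧ᶻ : ℤ → Carrier
  ⟦ + n ⟧ᶻ      = n × 1#
  ⟦ -[1+ n ] ⟧ᶻ = - (suc n × 1#)

  private
    -‿homo : ∀ i → ⟦ ℤ.- i ⟧ᶻ ≈ - ⟦ i ⟧ᶻ
    -‿homo -[1+ n ]    = sym (-‿involutive _)
    -‿homo (+ zero)    = sym -0#≈0#
    -‿homo (+ suc n)   = refl

    ⊖-homo : ∀ m n → ⟦ m ⊖ n ⟧ᶻ ≈ m × 1# + - (n × 1#)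
    ⊖-homo zero    zero    = sym (trans (+-congˡ -0#≈0#) (+-identityʳ _))
    ⊖-homo zero    (suc n) = sym (+-identityˡ _)
    ⊖-homo (suc m) zero    = sym (trans (+-congˡ -0#≈0#) (+-identityʳ _))
    ⊖-homo (suc m) (suc n) = begin
      ⟦ suc m ⊖ suc n ⟧ᶻ                 ≡⟨ P.cong ⟦_⟧ᶻ (ℤ.[1+m]⊖[1+n]≡m⊖n m n) ⟩
      ⟦ m ⊖ n ⟧ᶻ                         ≈⟨ ⊖-homo m n ⟩
      m × 1# + - (n × 1#)                ≈⟨ shift (m × 1#) (n × 1#) ⟩
      (1# + m × 1#) + - (1# + n × 1#)    ≈⟨ +-cong (1+× m 1#) (-‿cong (1+× n 1#)) ⟨
      suc m × 1# + - (suc n × 1#)        ∎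
      where
      shift : ∀ a b → a + - b ≈ (1# + a) + - (1# + b)
      shift a b = begin
        a + - b                    ≈⟨ +-identityˡ _ ⟨
        0# + (a + - b)             ≈⟨ +-congʳ (-‿inverseʳ 1#) ⟨
        (1# + - 1#) + (a + - b)    ≈⟨ +-assoc _ _ _ ⟩
        1# + (- 1# + (a + - b))    ≈⟨ +-congˡ (trans (sym (+-assoc _ _ _)) (trans (+-congʳ (+-comm _ _)) (+-assoc _ _ _))) ⟩
        1# + (a + (- 1# + - b))    ≈⟨ +-assoc _ _ _ ⟨
        (1# + a) + (- 1# + - b)    ≈⟨ +-congˡ (-‿+-comm 1# b) ⟩
        (1# + a) + - (1# + b)      ∎

    +-homo : ∀ i j → ⟦ i ℤ.+ j ⟧ᶻ ≈ ⟦ i ⟧ᶻ + ⟦ j ⟧ᶻ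
    +-homo -[1+ m ] -[1+ n ] = begin
      - (suc (suc (m ℕ.+ n)) × 1#)     ≡⟨ P.cong (λ k → - (suc k × 1#)) (P.sym (Data.Nat.Properties.+-suc m n)) ⟩
      - ((suc m ℕ.+ suc n) × 1#)       ≈⟨ -‿cong (×-homo-+ 1# (suc m) (suc n)) ⟩
      - (suc m × 1# + suc n × 1#)      ≈⟨ -‿+-comm _ _ ⟨
      - (suc m × 1#) + - (suc n × 1#)  ∎
      where import Data.Nat.Properties
    +-homo -[1+ m ] (+ n)    = trans (⊖-homo n (suc m)) (+-comm _ _)
    +-homo (+ m)    -[1+ n ] = ⊖-homo m (suc n)
    +-homo (+ m)    (+ n)    = ×-homo-+ 1# m n

    signed : Sign → Carrier → Carrier
    signed Sign.+ x = x
    signed Sign.- x = - x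

    signed-cong : ∀ s {x y} → x ≈ y → signed s x ≈ signed s y
    signed-cong Sign.+ e = e
    signed-cong Sign.- e = -‿cong e

    ◃-homo : ∀ s n → ⟦ s ℤ.◃ n ⟧ᶻ ≈ signed s (n × 1#)
    ◃-homo Sign.+ zero    = refl
    ◃-homo Sign.- zero    = sym -0#≈0#
    ◃-homo Sign.+ (suc n) = refl
    ◃-homo Sign.- (suc n) = refl

    sign-abs : ∀ i → ⟦ i ⟧ᶻ ≈ signed (ℤ.sign i) (ℤ.∣ i ∣ × 1#)
    sign-abs -[1+ n ]  = refl
    sign-abs (+ zero)  = refl
    sign-abs (+ suc n) = refl

    signed-* : ∀ s t x y → signed s x * signed t y ≈ signed (s Sign.* t) (x * y)
    signed-* Sign.+ Sign.+ x y = refl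
    signed-* Sign.+ Sign.- x y = sym (-‿distribʳ-* x y)
    signed-* Sign.- Sign.+ x y = sym (-‿distribˡ-* x y)
    signed-* Sign.- Sign.- x y =
      trans (sym (-‿distribˡ-* x (- y))) (trans (-‿cong (sym (-‿distribʳ-* x y))) (-‿involutive _))

    *-homo : ∀ i j → ⟦ i ℤ.* j ⟧ᶻ ≈ ⟦ i ⟧ᶻ * ⟦ j ⟧ᶻ
    *-homo i j = begin
      ⟦ i ℤ.* j ⟧ᶻ                                       ≈⟨ ◃-homo s (ℤ.∣ i ∣ ℕ.* ℤ.∣ j ∣) ⟩
      signed s ((ℤ.∣ i ∣ ℕ.* ℤ.∣ j ∣) × 1#)              ≈⟨ signed-cong s (×1-homo-* ℤ.∣ i ∣ ℤ.∣ j ∣) ⟩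
      signed s ((ℤ.∣ i ∣ × 1#) * (ℤ.∣ j ∣ × 1#))         ≈⟨ signed-* (ℤ.sign i) (ℤ.sign j) _ _ ⟨
      signed (ℤ.sign i) (ℤ.∣ i ∣ × 1#) * signed (ℤ.sign j) (ℤ.∣ j ∣ × 1#) ≈⟨ *-cong (sign-abs i) (sign-abs j) ⟨
      ⟦ i ⟧ᶻ * ⟦ j ⟧ᶻ                                     ∎
      where
      s : Sign
      s = ℤ.sign i Sign.* ℤ.sign j

    ℤ-homomorphism : ℤ.+-*-rawRing -Raw-AlmostCommutative⟶ fromCommutativeRing R
    ℤ-homomorphism = record
      { ⟦_⟧ = ⟦_⟧ᶻ ; +-homo = +-homo ; *-homo = *-homo ; -‿homo = -‿homo
      ; 0-homo = refl ; 1-homo = refl }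

    ℤ-equal? : ∀ i j → Maybe (⟦ i ⟧ᶻ ≈ ⟦ j ⟧ᶻ)
    ℤ-equal? i j with i ℤ.≟ j
    ... | yes P.refl = just refl
    ... | no _       = nothing

  open import Algebra.Solver.Ring ℤ.+-*-rawRing (fromCommutativeRing R) ℤ-homomorphism ℤ-equal? public

  :0 :1 : ∀ {n} → Polynomial n
  :0 = con (+ 0)
  :1 = con (+ 1)

module FinComparisons where
  open import Data.Bool using (true; false)
  open import Data.Nat as ℕ using (zero; suc; s≤s)
  open import Data.Fin as Fin using (_≤_)
  open import Relation.Binary.PropositionalEquality using (_≡_; _≢_; refl)
  open import Relation.Nullary using (yes; no)
  open import Relation.Nullary.Decidable using (dec-true; dec-false)

  private
    ℕ<ᵇ-true : ∀ {a b} → a ℕ.< b → (a ℕ.<ᵇ b) ≡ true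
    ℕ<ᵇ-true {zero}  {suc b} _       = refl
    ℕ<ᵇ-true {suc a} {suc b} (s≤s p) = ℕ<ᵇ-true p

    ℕ<ᵇ-false : ∀ {a b} → b ℕ.≤ a → (a ℕ.<ᵇ b) ≡ false
    ℕ<ᵇ-false {a}     {zero}  _       = refl
    ℕ<ᵇ-false {suc a} {suc b} (s≤s p) = ℕ<ᵇ-false p

    ℕ≤ᵇ-true : ∀ {a b} → a ℕ.≤ b → (a ℕ.≤ᵇ b) ≡ true
    ℕ≤ᵇ-true {zero}          _ = refl
    ℕ≤ᵇ-true {suc a} {suc b} p = ℕ<ᵇ-true p

    ℕ≤ᵇ-false : ∀ {a b} → a ℕ.< b → (b ℕ.≤ᵇ a) ≡ false
    ℕ≤ᵇ-false {a} {suc b} (s≤s p) = ℕ<ᵇ-false p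

  module _ {m} {x y : Fin m} where
    <ᵇ-true : x < y → (x <ᵇ y) ≡ true
    <ᵇ-true = ℕ<ᵇ-true

    <ᵇ-false : y ≤ x → (x <ᵇ y) ≡ false
    <ᵇ-false = ℕ<ᵇ-false

    ≤ᵇ-true : x ≤ y → (x ≤ᵇ y) ≡ true
    ≤ᵇ-true = ℕ≤ᵇ-true

    ≤ᵇ-false : x < y → (y ≤ᵇ x) ≡ false
    ≤ᵇ-false = ℕ≤ᵇ-false

    =ᵇ-≢ : x ≢ y → (x =ᵇ y) ≡ false
    =ᵇ-≢ = dec-false (x Fin.≟ y)

  =ᵇ-refl : ∀ {m} (x : Fin m) → (x =ᵇ x) ≡ true
  =ᵇ-refl x = dec-true (x Fin.≟ x) refl

  =ᵇ-suc : ∀ {m} (x y : Fin m) → (Fin.suc x =ᵇ Fin.suc y) ≡ (x =ᵇ y)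
  =ᵇ-suc x y with x Fin.≟ y
  ... | yes refl = refl
  ... | no _     = refl

module Expansion {c ℓ} (R : CommutativeRing c ℓ) where
  open import Level using (Level)
  open import Data.Nat as ℕ using (zero; suc; _≤_; s≤s)
  import Data.Nat.Properties as ℕ
  open import Data.List as List using (List; []; _∷_; _++_; map; length; [_])
  import Data.List.Properties as List
  open import Relation.Binary.PropositionalEquality as P using (_≡_)
  open import Data.List.Membership.Propositional using (_∈_)
  open import Data.List.Relation.Unary.Any using (here; there)
  open CommutativeRing R
  open IntegerCoefficientSolver R using (solve; _:=_; _:+_; _:*_; :-_; :0; :1)
  open import Relation.Binary.Reasoning.Setoid setoid

  private variable
    x : Level
    X Y : Set x

  sgn : ℕ → Carrier
  sgn zero    = 1#
  sgn (suc k) = - sgn k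

  -- expand g [y₀, …, yₘ] = Σₖ (-1)ᵏ g yₖ [y₀, …, yₖ₋₁, yₖ₊₁, …, yₘ]
  expand : (X → List X → Carrier) → List X → Carrier
  expand g []      = 0#
  expand g (y ∷ L) = g y L + - expand (λ z R → g z (y ∷ R)) L

  data Pick {X : Set x} : X → List X → List X → Set x where
    first : ∀ {y R} → Pick y R (y ∷ R)
    later : ∀ {y z R L} → Pick y R L → Pick y (z ∷ R) (z ∷ L)

  Pick⇒∈ : ∀ {y R L} → Pick {X = X} y R L → y ∈ L
  Pick⇒∈ first     = here P.refl
  Pick⇒∈ (later p) = there (Pick⇒∈ p)

  Pick⇒⊆ : ∀ {y R L z} → Pick {X = X} y R L → z ∈ R → z ∈ L
  Pick⇒⊆ first     q         = there q
  Pick⇒⊆ (later p) (here e)  = here e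
  Pick⇒⊆ (later p) (there q) = there (Pick⇒⊆ p q)

  Pick-length : ∀ {y R L} → Pick {X = X} y R L → suc (length R) ≡ length L
  Pick-length first     = P.refl
  Pick-length (later p) = P.cong suc (Pick-length p)

  expand-cong-on : ∀ {g g' : X → List X → Carrier} L →
    (∀ y R → Pick y R L → g y R ≈ g' y R) → expand g L ≈ expand g' L
  expand-cong-on []      h = refl
  expand-cong-on (y ∷ L) h = +-cong (h y L first) (-‿cong (expand-cong-on L (λ z R p → h z (y ∷ R) (later p))))

  expand-cong : ∀ {g g' : X → List X → Carrier} L → (∀ y R → g y R ≈ g' y R) → expand g L ≈ expand g' L
  expand-cong L h = expand-cong-on L (λ y R _ → h y R)

  expand-+ : ∀ (g h : X → List X → Carrier) L → expand (λ y R → g y R + h y R) L ≈ expand g L + expand h L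
  expand-+ g h []      = sym (+-identityˡ 0#)
  expand-+ g h (y ∷ L) = begin
    (g y L + h y L) + - expand (λ z R → g z (y ∷ R) + h z (y ∷ R)) L
      ≈⟨ +-congˡ (-‿cong (expand-+ (λ z R → g z (y ∷ R)) (λ z R → h z (y ∷ R)) L)) ⟩
    (g y L + h y L) + - (expand (λ z R → g z (y ∷ R)) L + expand (λ z R → h z (y ∷ R)) L)
      ≈⟨ solve 4 (λ a b d e → (a :+ b) :+ (:- (d :+ e)) := (a :+ (:- d)) :+ (b :+ (:- e))) refl _ _ _ _ ⟩
    (g y L + - expand (λ z R → g z (y ∷ R)) L) + (h y L + - expand (λ z R → h z (y ∷ R)) L) ∎

  expand-* : ∀ k (g : X → List X → Carrier) L → expand (λ y R → k * g y R) L ≈ k * expand g L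
  expand-* k g []      = sym (zeroʳ k)
  expand-* k g (y ∷ L) = begin
    k * g y L + - expand (λ z R → k * g z (y ∷ R)) L
      ≈⟨ +-congˡ (-‿cong (expand-* k (λ z R → g z (y ∷ R)) L)) ⟩
    k * g y L + - (k * expand (λ z R → g z (y ∷ R)) L)
      ≈⟨ solve 3 (λ k a b → k :* a :+ (:- (k :* b)) := k :* (a :+ (:- b))) refl _ _ _ ⟩
    k * (g y L + - expand (λ z R → g z (y ∷ R)) L) ∎

  expand-neg : ∀ (g : X → List X → Carrier) L → expand (λ y R → - g y R) L ≈ - expand g L
  expand-neg g L = begin
    expand (λ y R → - g y R) L       ≈⟨ expand-cong L (λ y R → solve 1 (λ a → :- a := (:- :1) :* a) refl (g y R)) ⟩
    expand (λ y R → - 1# * g y R) L  ≈⟨ expand-* (- 1#) g L ⟩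
    - 1# * expand g L                ≈⟨ solve 1 (λ a → (:- :1) :* a := :- a) refl _ ⟩
    - expand g L                     ∎

  expand-zero : ∀ {g : X → List X → Carrier} L → (∀ y R → Pick y R L → g y R ≈ 0#) → expand g L ≈ 0#
  expand-zero {g = g} L h = begin
    expand g L                  ≈⟨ expand-cong-on L (λ y R p → trans (h y R p) (sym (zeroˡ 0#))) ⟩
    expand (λ y R → 0# * 0#) L  ≈⟨ expand-* 0# (λ _ _ → 0#) L ⟩
    0# * expand (λ _ _ → 0#) L  ≈⟨ zeroˡ _ ⟩
    0#                          ∎

  expand-map : ∀ (φ : Y → X) (g : X → List X → Carrier) L →
    expand g (map φ L) ≈ expand (λ y R → g (φ y) (map φ R)) L
  expand-map φ g []      = refl
  expand-map φ g (y ∷ L) = +-congˡ (-‿cong (expand-map φ (λ z R → g z (φ y ∷ R)) L))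

  expand² : (X → X → List X → Carrier) → List X → Carrier
  expand² h L = expand (λ z R → expand (λ w R' → h z w R') R) L

  expand²-∷ : ∀ (h : X → X → List X → Carrier) y L →
    expand² h (y ∷ L) ≈ expand (h y) L + - (expand (λ z R → h z y R) L + - expand² (λ z w R → h z w (y ∷ R)) L)
  expand²-∷ h y L = +-congˡ (-‿cong (trans
    (expand-+ (λ z R → h z y R) (λ z R → - expand (λ w R' → h z w (y ∷ R')) R) L)
    (+-congˡ (expand-neg (λ z R → expand (λ w R' → h z w (y ∷ R')) R) L))))

  expand²-cong : ∀ {h h' : X → X → List X → Carrier} L →
    (∀ z w R → h z w R ≈ h' z w R) → expand² h L ≈ expand² h' L
  expand²-cong L e = expand-cong L (λ z R → expand-cong R (λ w R' → e z w R'))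

  expand²-flip : ∀ (h : X → X → List X → Carrier) L → expand² h L ≈ - expand² (λ z w → h w z) L
  expand²-flip h []      = sym -0#≈0#
    where open import Algebra.Properties.Ring ring using (-0#≈0#)
  expand²-flip h (y ∷ L) = begin
    expand² h (y ∷ L)        ≈⟨ expand²-∷ h y L ⟩
    a + - (b + - d)          ≈⟨ +-congˡ (-‿cong (+-congˡ (-‿cong (expand²-flip (λ z w R → h z w (y ∷ R)) L)))) ⟩
    a + - (b + - (- d′))     ≈⟨ solve 3 (λ a b d → a :+ (:- (b :+ (:- (:- d)))) := :- (b :+ (:- (a :+ (:- d))))) refl a b d′ ⟩
    - (b + - (a + - d′))     ≈⟨ -‿cong (expand²-∷ (λ z w → h w z) y L) ⟨
    - expand² (λ z w → h w z) (y ∷ L) ∎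
    where
    a b d d′ : Carrier
    a = expand (h y) L
    b = expand (λ z R → h z y R) L
    d = expand² (λ z w R → h z w (y ∷ R)) L
    d′ = expand² (λ z w R → h w z (y ∷ R)) L

  expand²-symmetric : ∀ (h : X → X → List X → Carrier) L → (∀ z w R → h z w R ≈ h w z R) → expand² h L ≈ 0#
  expand²-symmetric h []      s = refl
  expand²-symmetric h (y ∷ L) s = begin
    expand² h (y ∷ L)    ≈⟨ expand²-∷ h y L ⟩
    expand (h y) L + - (b + - expand² (λ z w R → h z w (y ∷ R)) L)
      ≈⟨ +-cong (expand-cong L (λ z R → s y z R))
                (-‿cong (+-congˡ (-‿cong (expand²-symmetric (λ z w R → h z w (y ∷ R)) L (λ z w R → s z w (y ∷ R)))))) ⟩
    b + - (b + - 0#)     ≈⟨ solve 1 (λ b → b :+ (:- (b :+ (:- :0))) := :0) refl b ⟩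
    0#                   ∎
    where
    b : Carrier
    b = expand (λ z R → h z y R) L

  -- The Pfaffian of ω restricted to the entries of a list, by expansion along the first entry;
  -- the fuel argument only has to be at least the length of the list.
  pf : (X → X → Carrier) → ℕ → List X → Carrier
  pf ω _       []      = 1#
  pf ω zero    (_ ∷ _) = 0#
  pf ω (suc n) (x ∷ L) = expand (λ y R → ω x y * pf ω n R) L

  pf-cong-on : ∀ {ω ω' : X → X → Carrier} n L →
    (∀ p q → p ∈ L → q ∈ L → ω p q ≈ ω' p q) → pf ω n L ≈ pf ω' n L
  pf-cong-on n       []      h = refl
  pf-cong-on zero    (x ∷ L) h = refl
  pf-cong-on (suc n) (x ∷ L) h = expand-cong-on L (λ y R p → *-cong (h x y (here P.refl) (there (Pick⇒∈ p)))
    (pf-cong-on n R (λ a b a∈ b∈ → h a b (there (Pick⇒⊆ p a∈)) (there (Pick⇒⊆ p b∈)))))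

  pf-cong : ∀ {ω ω' : X → X → Carrier} n L → (∀ p q → ω p q ≈ ω' p q) → pf ω n L ≈ pf ω' n L
  pf-cong n L h = pf-cong-on n L (λ p q _ _ → h p q)

  pf-map : ∀ (ω : X → X → Carrier) (φ : Y → X) n L → pf ω n (map φ L) ≈ pf (λ a b → ω (φ a) (φ b)) n L
  pf-map ω φ n       []      = refl
  pf-map ω φ zero    (x ∷ L) = refl
  pf-map ω φ (suc n) (x ∷ L) = trans (expand-map φ _ L) (expand-cong L (λ y R → *-congˡ (pf-map ω φ n R)))

  pf-fuel : ∀ (ω : X → X → Carrier) n m L → length L ≤ n → length L ≤ m → pf ω n L ≈ pf ω m L
  pf-fuel ω n       m       []      _       _       = refl
  pf-fuel ω (suc n) (suc m) (x ∷ L) (s≤s a) (s≤s b) =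
    expand-cong-on L (λ y R p → *-congˡ (pf-fuel ω n m R (shorter p a) (shorter p b)))
    where
    shorter : ∀ {y R L k} → Pick y R L → length L ≤ k → length R ≤ k
    shorter p le = ℕ.≤-trans (ℕ.n≤1+n _) (P.subst (_≤ _) (P.sym (Pick-length p)) le)

  pf-orthogonal-head : ∀ (ω : X → X → Carrier) n x y L → (∀ z → z ∈ L → ω x z ≈ 0#) →
    pf ω (suc n) (x ∷ y ∷ L) ≈ ω x y * pf ω n L
  pf-orthogonal-head ω n x y L h = begin
    ω x y * pf ω n L + - expand (λ z R → ω x z * pf ω n (y ∷ R)) L
      ≈⟨ +-congˡ (-‿cong (expand-zero L (λ z R p → trans (*-congʳ (h z (Pick⇒∈ p))) (zeroˡ _)))) ⟩
    ω x y * pf ω n L + - 0#     ≈⟨ solve 1 (λ a → a :+ (:- :0) := a) refl _ ⟩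
    ω x y * pf ω n L            ∎

  module Alternating {X : Set x} (ω : X → X → Carrier)
    (skew : ∀ a b → ω a b ≈ - ω b a) (alt : ∀ a → ω a a ≈ 0#) where

    private
      -0≈0 : - 0# ≈ 0#
      -0≈0 = solve 0 (:- :0 := :0) refl

    pf-swap-head : ∀ n x y L → pf ω n (x ∷ y ∷ L) ≈ - pf ω n (y ∷ x ∷ L)
    pf-swap-head zero x y L = sym -0≈0
    pf-swap-head (suc zero) x y L = begin
      ω x y * P + - expand (λ z R → ω x z * 0#) L   ≈⟨ +-cong (*-congʳ (skew x y)) (-‿cong (expand-zero L (λ _ _ _ → zeroʳ _))) ⟩
      - ω y x * P + - 0#                            ≈⟨ solve 2 (λ a p → (:- a) :* p :+ (:- :0) := :- (a :* p :+ (:- :0))) refl _ _ ⟩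
      - (ω y x * P + - 0#)                          ≈⟨ -‿cong (+-congˡ (-‿cong (expand-zero L (λ _ _ _ → zeroʳ _)))) ⟨
      - (ω y x * P + - expand (λ z R → ω y z * 0#) L) ∎
      where
      P : Carrier
      P = pf ω 0 L
    pf-swap-head (suc (suc m)) x y L = begin
      ω x y * P + - expand (λ z R → ω x z * expand (λ w R' → ω y w * pf ω m R') R) L
        ≈⟨ +-cong (*-congʳ (skew x y)) (-‿cong (as-expand² x y)) ⟩
      - ω y x * P + - expand² (h x y) L          ≈⟨ +-congˡ (-‿cong (expand²-flip (h x y) L)) ⟩
      - ω y x * P + - (- expand² (λ z w → h x y w z) L)
        ≈⟨ +-congˡ (-‿cong (-‿cong (expand²-cong L (λ z w R → solve 3 (λ a b p → a :* (b :* p) := b :* (a :* p)) refl _ _ _)))) ⟩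
      - ω y x * P + - (- expand² (h y x) L)      ≈⟨ solve 3 (λ a p d → (:- a) :* p :+ (:- (:- d)) := :- (a :* p :+ (:- d))) refl _ _ _ ⟩
      - (ω y x * P + - expand² (h y x) L)        ≈⟨ -‿cong (+-congˡ (-‿cong (as-expand² y x))) ⟨
      - (ω y x * P + - expand (λ z R → ω y z * expand (λ w R' → ω x w * pf ω m R') R) L) ∎
      where
      P : Carrier
      P = pf ω (suc m) L
      h : X → X → X → X → List X → Carrier
      h x y z w R = ω x z * (ω y w * pf ω m R)
      as-expand² : ∀ x y → expand (λ z R → ω x z * expand (λ w R' → ω y w * pf ω m R') R) L ≈ expand² (h x y) L
      as-expand² x y = expand-cong L (λ z R → sym (expand-* (ω x z) (λ w R' → ω y w * pf ω m R') R))

    pf-repeated-head : ∀ n x L → pf ω n (x ∷ x ∷ L) ≈ 0#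
    pf-repeated-head zero x L = refl
    pf-repeated-head (suc zero) x L = begin
      ω x x * pf ω 0 L + - expand (λ z R → ω x z * 0#) L ≈⟨ +-cong (*-congʳ (alt x)) (-‿cong (expand-zero L (λ _ _ _ → zeroʳ _))) ⟩
      0# * pf ω 0 L + - 0#                              ≈⟨ solve 1 (λ p → :0 :* p :+ (:- :0) := :0) refl _ ⟩
      0#                                                ∎
    pf-repeated-head (suc (suc m)) x L = begin
      ω x x * pf ω (suc m) L + - expand (λ z R → ω x z * expand (λ w R' → ω x w * pf ω m R') R) L
        ≈⟨ +-cong (*-congʳ (alt x)) (-‿cong (expand-cong L (λ z R → sym (expand-* (ω x z) (λ w R' → ω x w * pf ω m R') R)))) ⟩
      0# * pf ω (suc m) L + - expand² h L
        ≈⟨ +-congˡ (-‿cong (expand²-symmetric h L (λ z w R → solve 3 (λ a b p → a :* (b :* p) := b :* (a :* p)) refl _ _ _))) ⟩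
      0# * pf ω (suc m) L + - 0#  ≈⟨ solve 1 (λ p → :0 :* p :+ (:- :0) := :0) refl _ ⟩
      0#                          ∎
      where
      h : X → X → List X → Carrier
      h z w R = ω x z * (ω x w * pf ω m R)

    expand-swap : ∀ (g : X → List X → Carrier) a b post →
      (∀ y pre′ post′ → g y (pre′ ++ a ∷ b ∷ post′) ≈ - g y (pre′ ++ b ∷ a ∷ post′)) →
      ∀ pre → expand g (pre ++ a ∷ b ∷ post) ≈ - expand g (pre ++ b ∷ a ∷ post)
    expand-swap g a b post hyp [] = begin
      g a (b ∷ post) + - (g b (a ∷ post) + - expand (λ z R → g z (a ∷ b ∷ R)) post)
        ≈⟨ +-congˡ (-‿cong (+-congˡ (-‿cong (trans (expand-cong post (λ z R → hyp z [] R)) (expand-neg (λ z R → g z (b ∷ a ∷ R)) post))))) ⟩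
      g a (b ∷ post) + - (g b (a ∷ post) + - (- expand (λ z R → g z (b ∷ a ∷ R)) post))
        ≈⟨ solve 3 (λ p q d → p :+ (:- (q :+ (:- (:- d)))) := :- (q :+ (:- (p :+ (:- d))))) refl _ _ _ ⟩
      - (g b (a ∷ post) + - (g a (b ∷ post) + - expand (λ z R → g z (b ∷ a ∷ R)) post)) ∎
    expand-swap g a b post hyp (c ∷ pre) = begin
      g c (pre ++ a ∷ b ∷ post) + - expand g′ (pre ++ a ∷ b ∷ post)
        ≈⟨ +-cong (hyp c pre post) (-‿cong (expand-swap g′ a b post (λ y pre′ post′ → hyp y (c ∷ pre′) post′) pre)) ⟩
      - g c (pre ++ b ∷ a ∷ post) + - (- expand g′ (pre ++ b ∷ a ∷ post))
        ≈⟨ solve 2 (λ p d → (:- p) :+ (:- (:- d)) := :- (p :+ (:- d))) refl _ _ ⟩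
      - (g c (pre ++ b ∷ a ∷ post) + - expand g′ (pre ++ b ∷ a ∷ post)) ∎
      where
      g′ : X → List X → Carrier
      g′ z R = g z (c ∷ R)

    pf-swap : ∀ n pre a b post → pf ω n (pre ++ a ∷ b ∷ post) ≈ - pf ω n (pre ++ b ∷ a ∷ post)
    pf-swap n       []        a b post = pf-swap-head n a b post
    pf-swap zero    (x ∷ pre) a b post = sym -0≈0
    pf-swap (suc m) (x ∷ pre) a b post = expand-swap (λ y R → ω x y * pf ω m R) a b post
      (λ y pre′ post′ → trans (*-congˡ (pf-swap m pre′ a b post′)) (solve 2 (λ a b → a :* (:- b) := :- (a :* b)) refl _ _)) pre

    pf-move-front : ∀ n W M x Q → pf ω n (W ++ M ++ x ∷ Q) ≈ sgn (length M) * pf ω n (W ++ x ∷ M ++ Q)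
    pf-move-front n W []      x Q = sym (*-identityˡ _)
    pf-move-front n W (p ∷ M) x Q = begin
      pf ω n (W ++ p ∷ M ++ x ∷ Q)                     ≡⟨ P.cong (pf ω n) (P.sym (List.++-assoc W [ p ] (M ++ x ∷ Q))) ⟩
      pf ω n ((W ++ [ p ]) ++ M ++ x ∷ Q)              ≈⟨ pf-move-front n (W ++ [ p ]) M x Q ⟩
      sgn (length M) * pf ω n ((W ++ [ p ]) ++ x ∷ M ++ Q) ≡⟨ P.cong (λ z → sgn (length M) * pf ω n z) (List.++-assoc W [ p ] (x ∷ M ++ Q)) ⟩
      sgn (length M) * pf ω n (W ++ p ∷ x ∷ M ++ Q)    ≈⟨ *-congˡ (pf-swap n W p x (M ++ Q)) ⟩
      sgn (length M) * - pf ω n (W ++ x ∷ p ∷ M ++ Q)  ≈⟨ solve 2 (λ s q → s :* (:- q) := (:- s) :* q) refl _ _ ⟩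
      - sgn (length M) * pf ω n (W ++ x ∷ p ∷ M ++ Q)  ∎

    pf-repeated : ∀ n x M Q → pf ω n (x ∷ M ++ x ∷ Q) ≈ 0#
    pf-repeated n x M Q = trans (pf-move-front n [ x ] M x Q) (trans (*-congˡ (pf-repeated-head n x (M ++ Q))) (zeroʳ _))

    pf-repeated-second : ∀ n y x M Q → pf ω n (y ∷ x ∷ M ++ x ∷ Q) ≈ 0#
    pf-repeated-second n y x M Q = trans (pf-swap-head n y x (M ++ x ∷ Q)) (trans (-‿cong (pf-repeated n x (y ∷ M) Q)) -0≈0)

    expand-linear : ∀ (g : X → List X → Carrier) v v₁ v₂ k post →
      (∀ y pre′ post′ → g y (pre′ ++ v ∷ post′) ≈ g y (pre′ ++ v₁ ∷ post′) + k * g y (pre′ ++ v₂ ∷ post′)) →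
      (∀ R → g v R ≈ g v₁ R + k * g v₂ R) →
      ∀ pre → expand g (pre ++ v ∷ post) ≈ expand g (pre ++ v₁ ∷ post) + k * expand g (pre ++ v₂ ∷ post)
    expand-linear g v v₁ v₂ k post h₁ h₂ [] = begin
      g v post + - expand (λ z R → g z (v ∷ R)) post
        ≈⟨ +-cong (h₂ post) (-‿cong (trans (expand-cong post (λ z R → h₁ z [] R))
              (trans (expand-+ (λ z R → g z (v₁ ∷ R)) (λ z R → k * g z (v₂ ∷ R)) post) (+-congˡ (expand-* k (λ z R → g z (v₂ ∷ R)) post))))) ⟩
      (g v₁ post + k * g v₂ post) + - (expand (λ z R → g z (v₁ ∷ R)) post + k * expand (λ z R → g z (v₂ ∷ R)) post)
        ≈⟨ solve 5 (λ a b k d e → (a :+ k :* b) :+ (:- (d :+ k :* e)) := (a :+ (:- d)) :+ k :* (b :+ (:- e))) refl _ _ _ _ _ ⟩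
      (g v₁ post + - expand (λ z R → g z (v₁ ∷ R)) post) + k * (g v₂ post + - expand (λ z R → g z (v₂ ∷ R)) post) ∎
    expand-linear g v v₁ v₂ k post h₁ h₂ (c ∷ pre) = begin
      g c (pre ++ v ∷ post) + - expand g′ (pre ++ v ∷ post)
        ≈⟨ +-cong (h₁ c pre post) (-‿cong (expand-linear g′ v v₁ v₂ k post (λ y pre′ post′ → h₁ y (c ∷ pre′) post′) (λ R → h₂ (c ∷ R)) pre)) ⟩
      (g c (pre ++ v₁ ∷ post) + k * g c (pre ++ v₂ ∷ post)) + - (expand g′ (pre ++ v₁ ∷ post) + k * expand g′ (pre ++ v₂ ∷ post))
        ≈⟨ solve 5 (λ a b k d e → (a :+ k :* b) :+ (:- (d :+ k :* e)) := (a :+ (:- d)) :+ k :* (b :+ (:- e))) refl _ _ _ _ _ ⟩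
      (g c (pre ++ v₁ ∷ post) + - expand g′ (pre ++ v₁ ∷ post)) + k * (g c (pre ++ v₂ ∷ post) + - expand g′ (pre ++ v₂ ∷ post)) ∎
      where
      g′ : X → List X → Carrier
      g′ z R = g z (c ∷ R)

    pf-linear : ∀ v v₁ v₂ k → (∀ z → ω v z ≈ ω v₁ z + k * ω v₂ z) → (∀ z → ω z v ≈ ω z v₁ + k * ω z v₂) →
      ∀ n pre post → pf ω n (pre ++ v ∷ post) ≈ pf ω n (pre ++ v₁ ∷ post) + k * pf ω n (pre ++ v₂ ∷ post)
    pf-linear v v₁ v₂ k hl hr zero [] post = solve 1 (λ k → :0 := :0 :+ k :* :0) refl k
    pf-linear v v₁ v₂ k hl hr zero (x ∷ pre) post = solve 1 (λ k → :0 := :0 :+ k :* :0) refl k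
    pf-linear v v₁ v₂ k hl hr (suc n) [] post = begin
      expand (λ y R → ω v y * pf ω n R) post
        ≈⟨ expand-cong post (λ y R → trans (*-congʳ (hl y)) (solve 4 (λ a k b p → (a :+ k :* b) :* p := a :* p :+ k :* (b :* p)) refl _ _ _ _)) ⟩
      expand (λ y R → ω v₁ y * pf ω n R + k * (ω v₂ y * pf ω n R)) post
        ≈⟨ trans (expand-+ (λ y R → ω v₁ y * pf ω n R) (λ y R → k * (ω v₂ y * pf ω n R)) post) (+-congˡ (expand-* k (λ y R → ω v₂ y * pf ω n R) post)) ⟩
      expand (λ y R → ω v₁ y * pf ω n R) post + k * expand (λ y R → ω v₂ y * pf ω n R) post ∎
    pf-linear v v₁ v₂ k hl hr (suc n) (x ∷ pre) post = expand-linear (λ y R → ω x y * pf ω n R) v v₁ v₂ k post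
      (λ y pre′ post′ → trans (*-congˡ (pf-linear v v₁ v₂ k hl hr n pre′ post′)) (solve 4 (λ w a k b → w :* (a :+ k :* b) := w :* a :+ k :* (w :* b)) refl _ _ _ _))
      (λ R → trans (*-congʳ (hr x)) (solve 4 (λ a k b p → (a :+ k :* b) :* p := a :* p :+ k :* (b :* p)) refl _ _ _ _)) pre

module PermutationSums {c ℓ} (F : Field c ℓ) where
  open import Data.Bool as Bool using (Bool; true; false; if_then_else_; _∧_)
  open import Data.Nat as ℕ using (zero; suc; _≤_; s≤s)
  import Data.Nat.Properties as ℕ
  open import Data.Fin as Fin using (toℕ)
  open import Data.List as List using (List; []; _∷_; _++_; map; length; filterᵇ; allFin; concatMap; foldr)
  import Data.List.Properties as List
  open import Data.Product using (_×_; _,_; proj₁; proj₂)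
  open import Relation.Binary.PropositionalEquality as P using (_≡_)
  open import Data.List.Relation.Unary.All as All using (All; []; _∷_)
  import Data.List.Relation.Unary.All.Properties as All
  open import Data.List.Relation.Unary.AllPairs as AllPairs using (AllPairs; []; _∷_)
  open Field F
  open WithField F
  open Expansion commutativeRing
  open IntegerCoefficientSolver commutativeRing using (solve; _:=_; _:+_; _:*_; :-_; :1)
  open FinComparisons
  open import Relation.Binary.Reasoning.Setoid setoid

  ΣL : ∀ {A : Set} → List A → (A → Carrier) → Carrier
  ΣL xs f = sumL (map f xs)

  ΣL-++ : ∀ {A : Set} (xs ys : List A) f → ΣL (xs ++ ys) f ≈ ΣL xs f + ΣL ys f
  ΣL-++ []       ys f = sym (+-identityˡ _)
  ΣL-++ (x ∷ xs) ys f = trans (+-congˡ (ΣL-++ xs ys f)) (sym (+-assoc _ _ _))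

  ΣL-concatMap : ∀ {A B : Set} (g : A → List B) xs f → ΣL (concatMap g xs) f ≈ ΣL xs (λ τ → ΣL (g τ) f)
  ΣL-concatMap g []       f = refl
  ΣL-concatMap g (τ ∷ xs) f = trans (ΣL-++ (g τ) (concatMap g xs) f) (+-congˡ (ΣL-concatMap g xs f))

  ΣL-map : ∀ {A B : Set} (h : A → B) xs f → ΣL (map h xs) f ≈ ΣL xs (λ a → f (h a))
  ΣL-map h []       f = refl
  ΣL-map h (x ∷ xs) f = +-congˡ (ΣL-map h xs f)

  ΣL-cong-on : ∀ {A : Set} {xs : List A} {f g} → All (λ τ → f τ ≈ g τ) xs → ΣL xs f ≈ ΣL xs g
  ΣL-cong-on []       = refl
  ΣL-cong-on (e ∷ es) = +-cong e (ΣL-cong-on es)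

  ΣL-cong : ∀ {A : Set} (xs : List A) {f g} → (∀ τ → f τ ≈ g τ) → ΣL xs f ≈ ΣL xs g
  ΣL-cong xs e = ΣL-cong-on {xs = xs} (All.tabulate (λ {τ} _ → e τ))

  ΣL-+ : ∀ {A : Set} (xs : List A) f g → ΣL xs (λ τ → f τ + g τ) ≈ ΣL xs f + ΣL xs g
  ΣL-+ []       f g = sym (+-identityˡ _)
  ΣL-+ (x ∷ xs) f g = trans (+-congˡ (ΣL-+ xs f g)) (solve 4 (λ a b c d → (a :+ b) :+ (c :+ d) := (a :+ c) :+ (b :+ d)) refl _ _ _ _)

  ΣL-* : ∀ {A : Set} (xs : List A) k f → ΣL xs (λ τ → k * f τ) ≈ k * ΣL xs f
  ΣL-* []       k f = sym (zeroʳ k)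
  ΣL-* (x ∷ xs) k f = trans (+-congˡ (ΣL-* xs k f)) (sym (distribˡ _ _ _))

  ΣL-neg : ∀ {A : Set} (xs : List A) f → ΣL xs (λ τ → - f τ) ≈ - ΣL xs f
  ΣL-neg xs f = begin
    ΣL xs (λ τ → - f τ)       ≈⟨ ΣL-cong xs (λ τ → solve 1 (λ a → :- a := (:- :1) :* a) refl (f τ)) ⟩
    ΣL xs (λ τ → - 1# * f τ)  ≈⟨ ΣL-* xs (- 1#) f ⟩
    - 1# * ΣL xs f            ≈⟨ solve 1 (λ a → (:- :1) :* a := :- a) refl _ ⟩
    - ΣL xs f                 ∎

  ΣL-zero : ∀ {A : Set} {xs : List A} {f} → All (λ τ → f τ ≈ 0#) xs → ΣL xs f ≈ 0#
  ΣL-zero []       = refl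
  ΣL-zero (e ∷ es) = trans (+-cong e (ΣL-zero es)) (+-identityˡ _)

  ΣL-filter : ∀ {A : Set} (b : A → Bool) xs f → ΣL (filterᵇ b xs) f ≈ ΣL xs (λ τ → if b τ then f τ else 0#)
  ΣL-filter b []       f = refl
  ΣL-filter b (x ∷ xs) f with b x
  ... | true  = +-congˡ (ΣL-filter b xs f)
  ... | false = trans (ΣL-filter b xs f) (sym (+-identityˡ _))

  picks : ∀ {A : Set} → List A → List (A × List A)
  picks []       = []
  picks (x ∷ xs) = (x , xs) ∷ map (λ p → proj₁ p , x ∷ proj₂ p) (picks xs)

  picks-All : ∀ {A : Set} {Pr : A → Set} {L : List A} → All Pr L → All (λ p → Pr (proj₁ p)) (picks L)
  picks-All []         = []
  picks-All (px ∷ pxs) = px ∷ All.map⁺ (picks-All pxs)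

  ΣL-insertLater : ∀ {A : Set} → A → (List A → Carrier) → List A → Carrier
  ΣL-insertLater x f []      = 0#
  ΣL-insertLater x f (h ∷ τ) = ΣL (insertEverywhere x τ) (λ w → f (h ∷ w))

  ΣL-insertEverywhere : ∀ {A : Set} (x : A) τ f → ΣL (insertEverywhere x τ) f ≈ f (x ∷ τ) + ΣL-insertLater x f τ
  ΣL-insertEverywhere x []      f = refl
  ΣL-insertEverywhere x (h ∷ τ) f = +-congˡ (ΣL-map (h ∷_) (insertEverywhere x τ) f)

  ΣL-permutations-by-head : ∀ {A : Set} (x : A) R (f : List A → Carrier) →
    ΣL (permutations (x ∷ R)) f ≈ ΣL (picks (x ∷ R)) (λ p → ΣL (permutations (proj₂ p)) (λ v → f (proj₁ p ∷ v)))
  ΣL-permutations-by-head x []      f = ΣL-concatMap (insertEverywhere x) ([] ∷ []) f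
  ΣL-permutations-by-head {A} x (y ∷ R) f = begin
    ΣL (permutations (x ∷ y ∷ R)) f                     ≈⟨ ΣL-concatMap (insertEverywhere x) Perms f ⟩
    ΣL Perms (λ τ → ΣL (insertEverywhere x τ) f)        ≈⟨ ΣL-cong Perms (λ τ → ΣL-insertEverywhere x τ f) ⟩
    ΣL Perms (λ τ → f (x ∷ τ) + ΣL-insertLater x f τ)   ≈⟨ ΣL-+ Perms _ _ ⟩
    ΣL Perms (λ τ → f (x ∷ τ)) + ΣL Perms (ΣL-insertLater x f)
      ≈⟨ +-congˡ (ΣL-permutations-by-head y R (ΣL-insertLater x f)) ⟩
    ΣL Perms (λ τ → f (x ∷ τ)) + ΣL (picks (y ∷ R)) (λ p → ΣL (permutations (proj₂ p)) (λ v → ΣL (insertEverywhere x v) (λ w → f (proj₁ p ∷ w))))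
      ≈⟨ +-congˡ (ΣL-cong (picks (y ∷ R)) (λ p → sym (ΣL-concatMap (insertEverywhere x) (permutations (proj₂ p)) (λ w → f (proj₁ p ∷ w))))) ⟩
    ΣL Perms (λ τ → f (x ∷ τ)) + ΣL (picks (y ∷ R)) (λ p → ΣL (permutations (x ∷ proj₂ p)) (λ w → f (proj₁ p ∷ w)))
      ≈⟨ +-congˡ (sym (ΣL-map (λ p → proj₁ p , x ∷ proj₂ p) (picks (y ∷ R)) _)) ⟩
    ΣL (picks (x ∷ y ∷ R)) (λ p → ΣL (permutations (proj₂ p)) (λ v → f (proj₁ p ∷ v))) ∎
    where
    Perms : List (List A)
    Perms = permutations (y ∷ R)

  module FoldInvariance {A B : Set} (g : A → B → B) (b₀ : B)
    (left-comm : ∀ a a′ z → g a (g a′ z) ≡ g a′ (g a z)) where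

    foldr-insertEverywhere : ∀ x τ → All (λ w → foldr g b₀ w ≡ foldr g b₀ (x ∷ τ)) (insertEverywhere x τ)
    foldr-insertEverywhere x []       = P.refl ∷ []
    foldr-insertEverywhere x (y ∷ ys) =
      P.refl ∷ All.map⁺ (All.map (λ e → P.trans (P.cong (g y) e) (left-comm y x (foldr g b₀ ys))) (foldr-insertEverywhere x ys))

    foldr-permutations : ∀ L → All (λ τ → foldr g b₀ τ ≡ foldr g b₀ L) (permutations L)
    foldr-permutations []      = P.refl ∷ []
    foldr-permutations (x ∷ L) = All.concat⁺ (All.map⁺ (All.map
      (λ e → All.map (λ e′ → P.trans e′ (P.cong (g x) e)) (foldr-insertEverywhere x _)) (foldr-permutations L)))

  private
    ∧-left-comm : ∀ a b z → (a ∧ (b ∧ z)) ≡ (b ∧ (a ∧ z))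
    ∧-left-comm true  b     z = P.refl
    ∧-left-comm false true  z = P.refl
    ∧-left-comm false false z = P.refl

    +-left-comm : ∀ a b z → a ℕ.+ (b ℕ.+ z) ≡ b ℕ.+ (a ℕ.+ z)
    +-left-comm a b z = P.trans (P.sym (ℕ.+-assoc a b z)) (P.trans (P.cong (ℕ._+ z) (ℕ.+-comm a b)) (ℕ.+-assoc b a z))

  module _ {m : ℕ} where
    countGreater-permutations : ∀ (h : Fin m) L → All (λ τ → countGreater h τ ≡ countGreater h L) (permutations L)
    countGreater-permutations h L = All.map (λ {τ} e → P.trans (asFold τ) (P.trans e (P.sym (asFold L))))
      (FoldInvariance.foldr-permutations step 0 (λ a a′ → +-left-comm (gt a) (gt a′)) L)
      where
      gt : Fin m → ℕ
      gt a = if a <ᵇ h then 1 else 0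
      step : Fin m → ℕ → ℕ
      step a acc = gt a ℕ.+ acc
      asFold : ∀ w → countGreater h w ≡ foldr step 0 w
      asFold []      = P.refl
      asFold (y ∷ w) = P.cong (gt y ℕ.+_) (asFold w)

    ≤all-insertEverywhere : ∀ (h : Fin m) x τ → All (λ w → ≤all h w ≡ ≤all h (x ∷ τ)) (insertEverywhere x τ)
    ≤all-insertEverywhere h x τ = All.map (λ {w} e → P.trans (asFold w) (P.trans e (P.sym (asFold (x ∷ τ)))))
      (FoldInvariance.foldr-insertEverywhere step true (λ a a′ → ∧-left-comm (h ≤ᵇ a) (h ≤ᵇ a′)) x τ)
      where
      step : Fin m → Bool → Bool
      step a acc = (h ≤ᵇ a) ∧ acc
      asFold : ∀ w → ≤all h w ≡ foldr step true w
      asFold []      = P.refl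
      asFold (y ∷ w) = P.cong ((h ≤ᵇ y) ∧_) (asFold w)

    <all : Fin m → List (Fin m) → Bool
    <all x = foldr (λ a acc → (x <ᵇ a) ∧ acc) true

    <all-permutations : ∀ x L → All (λ τ → <all x τ ≡ <all x L) (permutations L)
    <all-permutations x = FoldInvariance.foldr-permutations _ true (λ a a′ → ∧-left-comm (x <ᵇ a) (x <ᵇ a′))

    length-permutations : ∀ (L : List (Fin m)) → All (λ τ → length τ ≡ length L) (permutations L)
    length-permutations = FoldInvariance.foldr-permutations (λ _ → suc) 0 (λ _ _ _ → P.refl)

    All<⇒<all : ∀ {x : Fin m} {L} → All (x Fin.<_) L → <all x L ≡ true
    All<⇒<all []       = P.refl
    All<⇒<all (p ∷ ps) rewrite <ᵇ-true p = All<⇒<all ps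

    <all⇒≤all : ∀ (x : Fin m) τ → <all x τ ≡ true → ≤all x τ ≡ true
    <all⇒≤all x []      e = P.refl
    <all⇒≤all x (y ∷ τ) e with x <ᵇ y in eq
    ... | true  = P.cong₂ _∧_ (≤ᵇ-true (ℕ.<⇒≤ (ℕ.<ᵇ⇒< (toℕ x) (toℕ y) (P.subst Bool.T (P.sym eq) _)))) (<all⇒≤all x τ e)

    <all⇒countGreater≡0 : ∀ (x : Fin m) τ → <all x τ ≡ true → countGreater x τ ≡ 0
    <all⇒countGreater≡0 x []      e = P.refl
    <all⇒countGreater≡0 x (y ∷ τ) e with x <ᵇ y in eq
    ... | true = P.cong₂ ℕ._+_ notLess (<all⇒countGreater≡0 x τ e)
      where
      notLess : (if y <ᵇ x then 1 else 0) ≡ 0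
      notLess rewrite <ᵇ-false {x = y} {y = x} (ℕ.<⇒≤ (ℕ.<ᵇ⇒< (toℕ x) (toℕ y) (P.subst Bool.T (P.sym eq) _))) = P.refl

    <all-head : ∀ (x : Fin m) h τ → <all x (h ∷ τ) ≡ true → x Fin.< h
    <all-head x h τ e with x <ᵇ h in eq
    ... | true = ℕ.<ᵇ⇒< (toℕ x) (toℕ h) (P.subst Bool.T (P.sym eq) _)

  signOf-suc : ∀ k → signOf (suc k) ≈ - signOf k
  signOf-suc k with isEven k
  ... | true  = refl
  ... | false = sym (solve 0 (:- (:- :1) := :1) refl)

  signOf-+ : ∀ a b → signOf (a ℕ.+ b) ≈ sgn a * signOf b
  signOf-+ zero    b = sym (*-identityˡ _)
  signOf-+ (suc a) b = trans (signOf-suc (a ℕ.+ b))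
    (trans (-‿cong (signOf-+ a b)) (solve 2 (λ s t → :- (s :* t) := (:- s) :* t) refl _ _))

  ΣL-picks-sign : ∀ {m} (L : List (Fin m)) → AllPairs Fin._<_ L → (g : Fin m → List (Fin m) → Carrier) →
    ΣL (picks L) (λ p → sgn (countGreater (proj₁ p) (proj₂ p)) * g (proj₁ p) (proj₂ p)) ≈ expand g L
  ΣL-picks-sign []      _                g = refl
  ΣL-picks-sign (z ∷ R) (z<R ∷ sortedR) g = +-cong
    (trans (*-congʳ (reflexive (P.cong sgn (<all⇒countGreater≡0 z R (All<⇒<all z<R))))) (*-identityˡ _))
    (begin
      ΣL (map (λ p → proj₁ p , z ∷ proj₂ p) (picks R)) _                      ≈⟨ ΣL-map _ (picks R) _ ⟩
      ΣL (picks R) (λ p → sgn (countGreater (proj₁ p) (z ∷ proj₂ p)) * g (proj₁ p) (z ∷ proj₂ p))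
        ≈⟨ ΣL-cong-on (All.map (λ {p} z<h → reflexive (P.cong (λ k → sgn (k ℕ.+ countGreater (proj₁ p) (proj₂ p)) * g (proj₁ p) (z ∷ proj₂ p)) (one z<h))) (picks-All z<R)) ⟩
      ΣL (picks R) (λ p → - sgn (countGreater (proj₁ p) (proj₂ p)) * g (proj₁ p) (z ∷ proj₂ p))
        ≈⟨ trans (ΣL-cong (picks R) (λ p → solve 2 (λ s a → (:- s) :* a := :- (s :* a)) refl _ _)) (ΣL-neg (picks R) _) ⟩
      - ΣL (picks R) (λ p → sgn (countGreater (proj₁ p) (proj₂ p)) * g (proj₁ p) (z ∷ proj₂ p))
        ≈⟨ -‿cong (ΣL-picks-sign R sortedR (λ h r → g h (z ∷ r))) ⟩
      - expand (λ h r → g h (z ∷ r)) R ∎)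
    where
    one : ∀ {h} → z Fin.< h → (if z <ᵇ h then 1 else 0) ≡ 1
    one z<h rewrite <ᵇ-true z<h = P.refl

  module PermutationPfaffian {m : ℕ} (Y : Mat m m) where
    term : List (Fin m) → Carrier
    term σ = signOf (inversions σ) * pairProduct Y σ

    termS′ : List (Fin m) → Carrier
    termS′ σ = if inS' σ then term σ else 0#

    permPf : List (Fin m) → Carrier
    permPf L = ΣL (filterᵇ inS' (permutations L)) term

    permPf-unfiltered : ∀ L → permPf L ≈ ΣL (permutations L) termS′
    permPf-unfiltered L = ΣL-filter inS' (permutations L) term

    -- the contribution of the words x ∷ h ∷ τ with x the least letter
    headTerm : Fin m → List (Fin m) → Carrier
    headTerm x []      = 0#
    headTerm x (h ∷ τ) = Y x h * (sgn (countGreater h τ) * termS′ τ)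

    termS′-minimal-head : ∀ x h τ → ≤all x (h ∷ τ) ≡ true → countGreater x (h ∷ τ) ≡ 0 →
      termS′ (x ∷ h ∷ τ) ≈ headTerm x (h ∷ τ)
    termS′-minimal-head x h τ e₁ e₂ with inS' τ
    ... | true rewrite e₁ | e₂ = begin
      signOf (countGreater h τ ℕ.+ inversions τ) * (Y x h * pairProduct Y τ)
        ≈⟨ *-congʳ (signOf-+ (countGreater h τ) (inversions τ)) ⟩
      (sgn (countGreater h τ) * signOf (inversions τ)) * (Y x h * pairProduct Y τ)
        ≈⟨ solve 4 (λ s t y p → (s :* t) :* (y :* p) := y :* (s :* (t :* p))) refl _ _ _ _ ⟩
      Y x h * (sgn (countGreater h τ) * (signOf (inversions τ) * pairProduct Y τ)) ∎
    ... | false rewrite e₁ = sym (trans (*-congˡ (zeroʳ _)) (zeroʳ _))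

    -- inserting the least letter x into τ gives an S′-word only at the front
    ΣL-insert-minimal : ∀ x h τ → <all x (h ∷ τ) ≡ true → ΣL (insertEverywhere x (h ∷ τ)) termS′ ≈ headTerm x (h ∷ τ)
    ΣL-insert-minimal x h τ gt = begin
      termS′ (x ∷ h ∷ τ) + ΣL (map (h ∷_) (insertEverywhere x τ)) termS′
        ≈⟨ +-cong (termS′-minimal-head x h τ (<all⇒≤all x (h ∷ τ) gt) (<all⇒countGreater≡0 x (h ∷ τ) gt))
                  (trans (ΣL-map (h ∷_) (insertEverywhere x τ) termS′) (ΣL-zero (All.map (λ {w} → notS′ {w}) (≤all-insertEverywhere h x τ)))) ⟩
      headTerm x (h ∷ τ) + 0#  ≈⟨ +-identityʳ _ ⟩
      headTerm x (h ∷ τ)       ∎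
      where
      h≰x : (h ≤ᵇ x) ≡ false
      h≰x = ≤ᵇ-false (<all-head x h τ gt)
      notS′ : ∀ {w} → ≤all h w ≡ ≤all h (x ∷ τ) → termS′ (h ∷ w) ≈ 0#
      notS′ {[]}    e rewrite h≰x with () ← e
      notS′ {z ∷ zs} e rewrite h≰x | e = refl

    ΣL-headTerm-permutations : ∀ x h r →
      ΣL (permutations r) (λ v → headTerm x (h ∷ v)) ≈ sgn (countGreater h r) * (Y x h * permPf r)
    ΣL-headTerm-permutations x h r = begin
      ΣL (permutations r) (λ v → Y x h * (sgn (countGreater h v) * termS′ v))
        ≈⟨ ΣL-cong-on (All.map (λ e → *-congˡ (*-congʳ (reflexive (P.cong sgn e)))) (countGreater-permutations h r)) ⟩
      ΣL (permutations r) (λ v → Y x h * (sgn (countGreater h r) * termS′ v))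
        ≈⟨ trans (ΣL-* (permutations r) (Y x h) _) (*-congˡ (ΣL-* (permutations r) _ termS′)) ⟩
      Y x h * (sgn (countGreater h r) * ΣL (permutations r) termS′) ≈⟨ *-congˡ (*-congˡ (permPf-unfiltered r)) ⟨
      Y x h * (sgn (countGreater h r) * permPf r)                   ≈⟨ solve 3 (λ a b c → a :* (b :* c) := b :* (a :* c)) refl _ _ _ ⟩
      sgn (countGreater h r) * (Y x h * permPf r)                   ∎

    permPf-expand : ∀ x y L → AllPairs Fin._<_ (x ∷ y ∷ L) → permPf (x ∷ y ∷ L) ≈ expand (λ h r → Y x h * permPf r) (y ∷ L)
    permPf-expand x y L (x<yL ∷ sorted) = begin
      permPf (x ∷ L′)                                             ≈⟨ permPf-unfiltered (x ∷ L′) ⟩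
      ΣL (permutations (x ∷ L′)) termS′                            ≈⟨ ΣL-concatMap (insertEverywhere x) Perms termS′ ⟩
      ΣL Perms (λ τ → ΣL (insertEverywhere x τ) termS′)
        ≈⟨ ΣL-cong-on (All.zipWith (λ {τ} (e₁ , e₂) → insert-minimal τ e₁ e₂) (length-permutations L′ , <all-permutations x L′)) ⟩
      ΣL Perms (headTerm x)                                        ≈⟨ ΣL-permutations-by-head y L (headTerm x) ⟩
      ΣL (picks L′) (λ p → ΣL (permutations (proj₂ p)) (λ v → headTerm x (proj₁ p ∷ v)))
        ≈⟨ ΣL-cong (picks L′) (λ p → ΣL-headTerm-permutations x (proj₁ p) (proj₂ p)) ⟩
      ΣL (picks L′) (λ p → sgn (countGreater (proj₁ p) (proj₂ p)) * (Y x (proj₁ p) * permPf (proj₂ p)))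
        ≈⟨ ΣL-picks-sign L′ sorted (λ h r → Y x h * permPf r) ⟩
      expand (λ h r → Y x h * permPf r) L′ ∎
      where
      L′ : List (Fin m)
      L′ = y ∷ L
      Perms : List (List (Fin m))
      Perms = permutations L′
      insert-minimal : ∀ τ → length τ ≡ length L′ → <all x τ ≡ <all x L′ → ΣL (insertEverywhere x τ) termS′ ≈ headTerm x τ
      insert-minimal (h ∷ τ) _ e = ΣL-insert-minimal x h τ (P.trans e (All<⇒<all x<yL))

    private
      Pick-sorted : ∀ {h : Fin m} {r L : List (Fin m)} → Pick h r L → AllPairs Fin._<_ L → AllPairs Fin._<_ r
      Pick-sorted first     (_ ∷ sorted)   = sorted
      Pick-sorted (later p) (a ∷ sorted)   = All.tabulate (λ q → All.lookup a (Pick⇒⊆ p q)) ∷ Pick-sorted p sorted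

      isEven-+2 : ∀ k → isEven (suc (suc k)) ≡ isEven k
      isEven-+2 k = Data.Bool.Properties.not-involutive (isEven k)
        where import Data.Bool.Properties

    permPf≈pf : ∀ N L → AllPairs Fin._<_ L → length L ≤ N → (if isEven (length L) then permPf L else 0#) ≈ pf Y N L
    permPf≈pf N       []          _      _ = trans (+-identityʳ _) (*-identityˡ _)
    permPf≈pf zero    (x ∷ [])    _      _ = refl
    permPf≈pf (suc N) (x ∷ [])    _      _ = refl
    permPf≈pf (suc N) (x ∷ y ∷ L) sorted (s≤s le) rewrite isEven-+2 (length L) with isEven (length L) in even
    ... | true  = trans (permPf-expand x y L sorted)
      (expand-cong-on (y ∷ L) (λ h r p → *-congˡ (trans (reflexive (parity p)) (permPf≈pf N r (Pick-sorted p (AllPairs.tail sorted)) (shorter p)))))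
      where
      shorter : ∀ {h r} → Pick h r (y ∷ L) → length r ≤ N
      shorter p = ℕ.≤-trans (ℕ.n≤1+n _) (P.subst (_≤ N) (P.sym (Pick-length p)) le)
      parity : ∀ {h r} → Pick h r (y ∷ L) → permPf r ≡ (if isEven (length r) then permPf r else 0#)
      parity p rewrite ℕ.suc-injective (Pick-length p) | even = P.refl
    ... | false = sym (expand-zero (y ∷ L) (λ h r p →
      trans (*-congˡ (sym (trans (reflexive (parity p)) (permPf≈pf N r (Pick-sorted p (AllPairs.tail sorted)) (shorter p))))) (zeroʳ _)))
      where
      shorter : ∀ {h r} → Pick h r (y ∷ L) → length r ≤ N
      shorter p = ℕ.≤-trans (ℕ.n≤1+n _) (P.subst (_≤ N) (P.sym (Pick-length p)) le)
      parity : ∀ {h r} → Pick h r (y ∷ L) → 0# ≡ (if isEven (length r) then permPf r else 0#)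
      parity p rewrite ℕ.suc-injective (Pick-length p) | even = P.refl

  allFin-sorted : ∀ n → AllPairs Fin._<_ (allFin n)
  allFin-sorted n = Data.List.Relation.Unary.AllPairs.Properties.tabulate⁺-< (λ p → p)
    where import Data.List.Relation.Unary.AllPairs.Properties

  Pf≈pf : ∀ {m} (Y : Mat m m) N → m ≤ N → Pf Y ≈ pf Y N (allFin m)
  Pf≈pf {m} Y N le = trans
    (reflexive (P.cong (λ k → if isEven k then permPf (allFin m) else 0#) (P.sym (List.length-tabulate {n = m} (λ x → x)))))
    (permPf≈pf N (allFin m) (allFin-sorted m) (P.subst (_≤ N) (P.sym (List.length-tabulate {n = m} (λ x → x))) le))
    where open PermutationPfaffian Y

  length-filterᵇ-allFin : ∀ {n} (b : Fin n → Bool) → length (filterᵇ b (allFin n)) ≤ n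
  length-filterᵇ-allFin {n} b = ℕ.≤-trans (List.length-filter _ (allFin n)) (ℕ.≤-reflexive (List.length-tabulate (λ x → x)))

  PfSub≈pf : ∀ {n} (X : Mat n n) (S : Subset n) N → n ≤ N → PfSub X S ≈ pf X N (elems S)
  PfSub≈pf {n} X S N le = begin
    PfSub X S                                                   ≈⟨ Pf≈pf _ N (ℕ.≤-trans (length-filterᵇ-allFin _) le) ⟩
    pf (λ p q → X (List.lookup es p) (List.lookup es q)) N (allFin (length es)) ≈⟨ pf-map X (List.lookup es) N (allFin (length es)) ⟨
    pf X N (map (List.lookup es) (allFin (length es)))
      ≡⟨ P.cong (pf X N) (P.trans (List.map-tabulate (λ x → x) (List.lookup es)) (List.tabulate-lookup es)) ⟩
    pf X N es                                                   ∎
    where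
    es : List (Fin n)
    es = elems S

-- Entries are evaluated on formal
-- combinations s·eₖ + x·eᵢ + y·eⱼ of basis vectors through the bilinear form ω of M, and the
-- Pfaffian identities come from shearing such combinations back to basis vectors.
module Pivoting {c ℓ} (R : CommutativeRing c ℓ) where
  open CommutativeRing R

  module Pivot {n : ℕ} (M : Fin n → Fin n → Carrier)
    (skew : ∀ k l → M k l ≈ - M l k) (alt : ∀ k → M k k ≈ 0#)
    (i j : Fin n) (γ : Carrier) (γ-inv : γ * M i j ≈ 1#) where
    open import Data.Nat using (suc)
    open import Data.List as List using (List; []; _∷_; _++_; map; [_])
    import Data.List.Properties as List
    open import Data.Product using (_,_)
    import Relation.Binary.PropositionalEquality as P
    open import Data.List.Membership.Propositional using (_∈_)
    open import Data.List.Membership.Propositional.Properties using (∈-map⁻)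
    open IntegerCoefficientSolver R using (solve; _:=_; _:+_; _:*_; :-_; :0; :1; Polynomial)
    open Expansion R
    open import Relation.Binary.Reasoning.Setoid setoid

    schur : Fin n → Fin n → Carrier
    schur s t = M s t + (M s i * M j t + - (M s j * M i t)) * γ

    data Combination : Set c where
      comb : (s : Carrier) (k : Fin n) (x y : Carrier) → Combination

    bilinear : (s x y s′ x′ y′ mkl mki mkj mil mii mij mjl mji mjj : Carrier) → Carrier
    bilinear s x y s′ x′ y′ mkl mki mkj mil mii mij mjl mji mjj =
      s * s′ * mkl + s * x′ * mki + s * y′ * mkj + x * s′ * mil + x * x′ * mii + x * y′ * mij + y * s′ * mjl + y * x′ * mji + y * y′ * mjj

    bilinearₚ : ∀ {k} (s x y s′ x′ y′ mkl mki mkj mil mii mij mjl mji mjj : Polynomial k) → Polynomial k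
    bilinearₚ s x y s′ x′ y′ mkl mki mkj mil mii mij mjl mji mjj =
      s :* s′ :* mkl :+ s :* x′ :* mki :+ s :* y′ :* mkj :+ x :* s′ :* mil :+ x :* x′ :* mii :+ x :* y′ :* mij :+ y :* s′ :* mjl :+ y :* x′ :* mji :+ y :* y′ :* mjj

    bilinear-cong : ∀ {s x y s′ x′ y′} {a a′ b b′ d d′ e e′ f f′ g g′ h h′ p p′ q q′} →
      a ≈ a′ → b ≈ b′ → d ≈ d′ → e ≈ e′ → f ≈ f′ → g ≈ g′ → h ≈ h′ → p ≈ p′ → q ≈ q′ →
      bilinear s x y s′ x′ y′ a b d e f g h p q ≈ bilinear s x y s′ x′ y′ a′ b′ d′ e′ f′ g′ h′ p′ q′
    bilinear-cong ea eb ed ee ef eg eh ep eq = +-cong (+-cong (+-cong (+-cong (+-cong (+-cong (+-cong (+-cong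
      (*-congˡ ea) (*-congˡ eb)) (*-congˡ ed)) (*-congˡ ee)) (*-congˡ ef)) (*-congˡ eg)) (*-congˡ eh)) (*-congˡ ep)) (*-congˡ eq)

    ω : Combination → Combination → Carrier
    ω (comb s k x y) (comb s′ l x′ y′) =
      bilinear s x y s′ x′ y′ (M k l) (M k i) (M k j) (M i l) (M i i) (M i j) (M j l) (M j i) (M j j)

    ω-skew : ∀ a b → ω a b ≈ - ω b a
    ω-skew (comb s k x y) (comb s′ l x′ y′) = begin
      bilinear s x y s′ x′ y′ (M k l) (M k i) (M k j) (M i l) (M i i) (M i j) (M j l) (M j i) (M j j)
        ≈⟨ solve 15 (λ s x y s′ x′ y′ a b d e f g h p q →
             bilinearₚ s x y s′ x′ y′ a b d e f g h p q
               := :- bilinearₚ s′ x′ y′ s x y (:- a) (:- e) (:- h) (:- b) (:- f) (:- p) (:- d) (:- g) (:- q))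
             refl s x y s′ x′ y′ (M k l) (M k i) (M k j) (M i l) (M i i) (M i j) (M j l) (M j i) (M j j) ⟩
      - bilinear s′ x′ y′ s x y (- M k l) (- M i l) (- M j l) (- M k i) (- M i i) (- M j i) (- M k j) (- M i j) (- M j j)
        ≈⟨ -‿cong (bilinear-cong (skew l k) (skew l i) (skew l j) (skew i k) (skew i i) (skew i j) (skew j k) (skew j i) (skew j j)) ⟨
      - bilinear s′ x′ y′ s x y (M l k) (M l i) (M l j) (M i k) (M i i) (M i j) (M j k) (M j i) (M j j) ∎

    ω-alt : ∀ a → ω a a ≈ 0#
    ω-alt (comb s k x y) = begin
      bilinear s x y s x y (M k k) (M k i) (M k j) (M i k) (M i i) (M i j) (M j k) (M j i) (M j j)
        ≈⟨ bilinear-cong (alt k) refl refl (skew i k) (alt i) refl (skew j k) (skew j i) (alt j) ⟩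
      bilinear s x y s x y 0# (M k i) (M k j) (- M k i) 0# (M i j) (- M k j) (- M i j) 0#
        ≈⟨ solve 6 (λ s x y b d g → bilinearₚ s x y s x y :0 b d (:- b) :0 g (:- d) (:- g) :0 := :0) refl s x y (M k i) (M k j) (M i j) ⟩
      0# ∎

    open Alternating ω ω-skew ω-alt

    e : Fin n → Combination
    e t = comb 1# t 0# 0#

    eᵢ eⱼ : Combination
    eᵢ = e i
    eⱼ = e j

    ω-e : ∀ a b → ω (e a) (e b) ≈ M a b
    ω-e a b = solve 9 (λ a b d e f g h p q → bilinearₚ :1 :0 :0 :1 :0 :0 a b d e f g h p q := a)
      refl (M a b) (M a i) (M a j) (M i b) (M i i) (M i j) (M j b) (M j i) (M j j)

    private
      ω-linearʳ : ∀ {a a₁ a₂} k → (∀ z → ω a z ≈ ω a₁ z + k * ω a₂ z) → (∀ z → ω z a ≈ ω z a₁ + k * ω z a₂)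
      ω-linearʳ {a} {a₁} {a₂} k h z = begin
        ω z a                        ≈⟨ ω-skew z a ⟩
        - ω a z                      ≈⟨ -‿cong (h z) ⟩
        - (ω a₁ z + k * ω a₂ z)      ≈⟨ -‿cong (+-cong (ω-skew a₁ z) (*-congˡ (ω-skew a₂ z))) ⟩
        - (- ω z a₁ + k * - ω z a₂)  ≈⟨ solve 3 (λ p k q → :- ((:- p) :+ k :* (:- q)) := p :+ k :* q) refl _ _ _ ⟩
        ω z a₁ + k * ω z a₂          ∎

      ω-splitⱼ : ∀ s k x y z → ω (comb s k x y) z ≈ ω (comb s k x 0#) z + y * ω eⱼ z
      ω-splitⱼ s k x y (comb s′ l x′ y′) = solve 15 (λ s x y s′ x′ y′ a b d e f g h p q →
          bilinearₚ s x y s′ x′ y′ a b d e f g h p q := bilinearₚ s x :0 s′ x′ y′ a b d e f g h p q :+ y :* bilinearₚ :1 :0 :0 s′ x′ y′ h p q e f g h p q)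
        refl s x y s′ x′ y′ (M k l) (M k i) (M k j) (M i l) (M i i) (M i j) (M j l) (M j i) (M j j)

      ω-splitᵢ : ∀ s k x z → ω (comb s k x 0#) z ≈ ω (comb s k 0# 0#) z + x * ω eᵢ z
      ω-splitᵢ s k x (comb s′ l x′ y′) = solve 15 (λ s x y s′ x′ y′ a b d e f g h p q →
          bilinearₚ s x :0 s′ x′ y′ a b d e f g h p q := bilinearₚ s :0 :0 s′ x′ y′ a b d e f g h p q :+ x :* bilinearₚ :1 :0 :0 s′ x′ y′ e f g e f g h p q)
        refl s x 0# s′ x′ y′ (M k l) (M k i) (M k j) (M i l) (M i i) (M i j) (M j l) (M j i) (M j j)

      +-absorbs-zero : ∀ {a b} k → b ≈ 0# → a + k * b ≈ a
      +-absorbs-zero {a} k b≈0 = trans (+-congˡ (trans (*-congˡ b≈0) (zeroʳ k))) (+-identityʳ a)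

    pf-dropⱼ : ∀ N pre post s k x y → pf ω N (pre ++ eⱼ ∷ post) ≈ 0# →
      pf ω N (pre ++ comb s k x y ∷ post) ≈ pf ω N (pre ++ comb s k x 0# ∷ post)
    pf-dropⱼ N pre post s k x y zero = trans
      (pf-linear (comb s k x y) (comb s k x 0#) eⱼ y (ω-splitⱼ s k x y) (ω-linearʳ y (ω-splitⱼ s k x y)) N pre post)
      (+-absorbs-zero y zero)

    pf-dropᵢ : ∀ N pre post s k x → pf ω N (pre ++ eᵢ ∷ post) ≈ 0# →
      pf ω N (pre ++ comb s k x 0# ∷ post) ≈ pf ω N (pre ++ comb s k 0# 0# ∷ post)
    pf-dropᵢ N pre post s k x zero = trans
      (pf-linear (comb s k x 0#) (comb s k 0# 0#) eᵢ x (ω-splitᵢ s k x) (ω-linearʳ x (ω-splitᵢ s k x)) N pre post)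
      (+-absorbs-zero x zero)

    pf-unshear : ∀ N H (h : Fin n → Combination) →
      (∀ P t Q → pf ω N (H ++ P ++ h t ∷ Q) ≈ pf ω N (H ++ P ++ e t ∷ Q)) →
      ∀ P T → pf ω N (H ++ P ++ map h T) ≈ pf ω N (H ++ P ++ map e T)
    pf-unshear N H h step P []      = refl
    pf-unshear N H h step P (t ∷ T) = begin
      pf ω N (H ++ P ++ h t ∷ map h T)          ≈⟨ step P t (map h T) ⟩
      pf ω N (H ++ P ++ e t ∷ map h T)          ≡⟨ P.cong (λ z → pf ω N (H ++ z)) (P.sym (List.++-assoc P [ e t ] (map h T))) ⟩
      pf ω N (H ++ (P ++ [ e t ]) ++ map h T)   ≈⟨ pf-unshear N H h step (P ++ [ e t ]) T ⟩
      pf ω N (H ++ (P ++ [ e t ]) ++ map e T)   ≡⟨ P.cong (λ z → pf ω N (H ++ z)) (List.++-assoc P [ e t ] (map e T)) ⟩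
      pf ω N (H ++ P ++ e t ∷ map e T)          ∎

    sheared shearedᵢ shearedⱼ : Fin n → Combination
    sheared t  = comb 1# t (M j t * γ) (- (M i t * γ))
    shearedᵢ t = comb 1# t (M j t * γ) 0#
    shearedⱼ t = comb 1# t 0# (- (M i t * γ))

    cancel-γ : ∀ K → K * (1# + - (γ * M i j)) ≈ 0#
    cancel-γ K = trans (*-congˡ (+-congˡ (-‿cong γ-inv))) (solve 1 (λ k → k :* (:1 :+ (:- :1)) := :0) refl K)

    ω-eᵢ-sheared : ∀ t → ω eᵢ (sheared t) ≈ 0#
    ω-eᵢ-sheared t = begin
      ω eᵢ (sheared t)  ≈⟨ bilinear-cong refl (alt i) refl refl (alt i) refl refl refl refl ⟩
      bilinear 1# 0# 0# 1# (M j t * γ) (- (M i t * γ)) (M i t) 0# (M i j) (M i t) 0# (M i j) (M j t) (M j i) (M j j)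
        ≈⟨ solve 7 (λ c a b d g h p →
             bilinearₚ :1 :0 :0 :1 (h :* c) (:- (a :* c)) a :0 g a :0 g h p d := a :* (:1 :+ (:- (c :* g))))
             refl γ (M i t) (M i i) (M j j) (M i j) (M j t) (M j i) ⟩
      M i t * (1# + - (γ * M i j)) ≈⟨ cancel-γ (M i t) ⟩
      0#                           ∎

    ω-sheared : ∀ s t → ω (sheared s) (sheared t) ≈ schur s t
    ω-sheared s t = begin
      ω (sheared s) (sheared t) ≈⟨ bilinear-cong refl refl refl refl (alt i) refl refl (skew j i) (alt j) ⟩
      bilinear 1# (M j s * γ) (- (M i s * γ)) 1# (M j t * γ) (- (M i t * γ)) (M s t) (M s i) (M s j) (M i t) 0# (M i j) (M j t) (- M i j) 0#
        ≈⟨ solve 9 (λ c st si sj it ij jt js is →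
             bilinearₚ :1 (js :* c) (:- (is :* c)) :1 (jt :* c) (:- (it :* c)) st si sj it :0 ij jt (:- ij) :0
               := (st :+ (si :* jt :+ (:- (sj :* it))) :* c) :+ (c :* (js :* it :+ (:- (is :* jt)))) :* (:1 :+ (:- (c :* ij))))
             refl γ (M s t) (M s i) (M s j) (M i t) (M i j) (M j t) (M j s) (M i s) ⟩
      schur s t + (γ * (M j s * M i t + - (M i s * M j t))) * (1# + - (γ * M i j)) ≈⟨ +-congˡ (cancel-γ _) ⟩
      schur s t + 0#            ≈⟨ +-identityʳ _ ⟩
      schur s t                 ∎

    ω-eⱼ-shearedⱼ : ∀ t → ω eⱼ (shearedⱼ t) ≈ M j t
    ω-eⱼ-shearedⱼ t = trans (bilinear-cong refl refl (alt j) refl refl refl refl refl (alt j))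
      (solve 9 (λ c a b d e f g h p → bilinearₚ :1 :0 :0 :1 :0 (:- (p :* c)) a b :0 d e f g h :0 := a)
        refl γ (M j t) (M j i) (M i t) (M i i) (M i j) (M j t) (M j i) (M i t))

    ω-eᵢ-shearedᵢ : ∀ t → ω eᵢ (shearedᵢ t) ≈ M i t
    ω-eᵢ-shearedᵢ t = trans (bilinear-cong refl (alt i) refl refl (alt i) refl refl refl refl)
      (solve 9 (λ c a b d e f g h p → bilinearₚ :1 :0 :0 :1 (p :* c) :0 a :0 b d :0 e f g h := a)
        refl γ (M i t) (M i j) (M i t) (M i j) (M j t) (M j i) (M j j) (M j t))

    ω-shearedⱼ : ∀ s t → ω (shearedⱼ s) (shearedⱼ t) ≈ schur s t
    ω-shearedⱼ s t = begin
      ω (shearedⱼ s) (shearedⱼ t) ≈⟨ bilinear-cong refl refl refl refl refl refl refl refl (alt j) ⟩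
      bilinear 1# 0# (- (M i s * γ)) 1# 0# (- (M i t * γ)) (M s t) (M s i) (M s j) (M i t) (M i i) (M i j) (M j t) (M j i) 0#
        ≈⟨ solve 10 (λ c st si sj it ii ij jt ji is →
             bilinearₚ :1 :0 (:- (is :* c)) :1 :0 (:- (it :* c)) st si sj it ii ij jt ji :0
               := st :+ ((:- is) :* jt :+ (:- (sj :* it))) :* c)
             refl γ (M s t) (M s i) (M s j) (M i t) (M i i) (M i j) (M j t) (M j i) (M i s) ⟩
      M s t + (- M i s * M j t + - (M s j * M i t)) * γ ≈⟨ +-congˡ (*-congʳ (+-congʳ (*-congʳ (skew s i)))) ⟨
      schur s t                   ∎

    ω-shearedᵢ : ∀ s t → ω (shearedᵢ s) (shearedᵢ t) ≈ schur s t
    ω-shearedᵢ s t = begin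
      ω (shearedᵢ s) (shearedᵢ t) ≈⟨ bilinear-cong refl refl refl refl (alt i) refl refl refl refl ⟩
      bilinear 1# (M j s * γ) 0# 1# (M j t * γ) 0# (M s t) (M s i) (M s j) (M i t) 0# (M i j) (M j t) (M j i) (M j j)
        ≈⟨ solve 10 (λ c st si sj it ij jt ji jj js →
             bilinearₚ :1 (js :* c) :0 :1 (jt :* c) :0 st si sj it :0 ij jt ji jj
               := st :+ (si :* jt :+ (:- ((:- js) :* it))) :* c)
             refl γ (M s t) (M s i) (M s j) (M i t) (M i j) (M j t) (M j i) (M j j) (M j s) ⟩
      M s t + (M s i * M j t + - (- M j s * M i t)) * γ ≈⟨ +-congˡ (*-congʳ (+-congˡ (-‿cong (*-congʳ (skew s j))))) ⟨
      schur s t                   ∎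

    pf-via-ω : ∀ N L → pf M N L ≈ pf ω N (map e L)
    pf-via-ω N L = sym (trans (pf-map ω e N L) (pf-cong N L ω-e))

    pf-pivots-head : ∀ N T → pf M (suc N) (i ∷ j ∷ T) ≈ M i j * pf schur N T
    pf-pivots-head N T = begin
      pf M (suc N) (i ∷ j ∷ T)             ≈⟨ pf-via-ω (suc N) (i ∷ j ∷ T) ⟩
      pf ω (suc N) (eᵢ ∷ eⱼ ∷ map e T)     ≈⟨ pf-unshear (suc N) (eᵢ ∷ eⱼ ∷ []) sheared unshear-step [] T ⟨
      pf ω (suc N) (eᵢ ∷ eⱼ ∷ map sheared T) ≈⟨ pf-orthogonal-head ω N eᵢ eⱼ (map sheared T) orthogonal ⟩
      ω eᵢ eⱼ * pf ω N (map sheared T)      ≈⟨ *-cong (ω-e i j) (trans (pf-map ω sheared N T) (pf-cong N T ω-sheared)) ⟩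
      M i j * pf schur N T                 ∎
      where
      unshear-step : ∀ P t Q → pf ω (suc N) (eᵢ ∷ eⱼ ∷ P ++ sheared t ∷ Q) ≈ pf ω (suc N) (eᵢ ∷ eⱼ ∷ P ++ e t ∷ Q)
      unshear-step P t Q = trans (pf-dropⱼ (suc N) (eᵢ ∷ eⱼ ∷ P) Q 1# t (M j t * γ) (- (M i t * γ)) (pf-repeated-second (suc N) eᵢ eⱼ P Q))
                                 (pf-dropᵢ (suc N) (eᵢ ∷ eⱼ ∷ P) Q 1# t (M j t * γ) (pf-repeated (suc N) eᵢ (eⱼ ∷ P) Q))
      orthogonal : ∀ z → z ∈ map sheared T → ω eᵢ z ≈ 0#
      orthogonal z z∈ with ∈-map⁻ sheared z∈
      ... | t , _ , P.refl = ω-eᵢ-sheared t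

    pf-pivotⱼ-head : ∀ N T → pf M (suc N) (j ∷ T) ≈ expand (λ y R → M j y * pf schur N R) T
    pf-pivotⱼ-head N T = begin
      pf M (suc N) (j ∷ T)                                    ≈⟨ pf-via-ω (suc N) (j ∷ T) ⟩
      pf ω (suc N) (eⱼ ∷ map e T)                             ≈⟨ pf-unshear (suc N) [ eⱼ ] shearedⱼ unshear-step [] T ⟨
      expand (λ y R → ω eⱼ y * pf ω N R) (map shearedⱼ T)     ≈⟨ expand-map shearedⱼ _ T ⟩
      expand (λ y R → ω eⱼ (shearedⱼ y) * pf ω N (map shearedⱼ R)) T
        ≈⟨ expand-cong T (λ y R → *-cong (ω-eⱼ-shearedⱼ y) (trans (pf-map ω shearedⱼ N R) (pf-cong N R ω-shearedⱼ))) ⟩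
      expand (λ y R → M j y * pf schur N R) T                 ∎
      where
      unshear-step : ∀ P t Q → pf ω (suc N) (eⱼ ∷ P ++ shearedⱼ t ∷ Q) ≈ pf ω (suc N) (eⱼ ∷ P ++ e t ∷ Q)
      unshear-step P t Q = pf-dropⱼ (suc N) (eⱼ ∷ P) Q 1# t 0# (- (M i t * γ)) (pf-repeated (suc N) eⱼ P Q)

    pf-pivotᵢ-head : ∀ N T → pf M (suc N) (i ∷ T) ≈ expand (λ y R → M i y * pf schur N R) T
    pf-pivotᵢ-head N T = begin
      pf M (suc N) (i ∷ T)                                    ≈⟨ pf-via-ω (suc N) (i ∷ T) ⟩
      pf ω (suc N) (eᵢ ∷ map e T)                             ≈⟨ pf-unshear (suc N) [ eᵢ ] shearedᵢ unshear-step [] T ⟨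
      expand (λ y R → ω eᵢ y * pf ω N R) (map shearedᵢ T)     ≈⟨ expand-map shearedᵢ _ T ⟩
      expand (λ y R → ω eᵢ (shearedᵢ y) * pf ω N (map shearedᵢ R)) T
        ≈⟨ expand-cong T (λ y R → *-cong (ω-eᵢ-shearedᵢ y) (trans (pf-map ω shearedᵢ N R) (pf-cong N R ω-shearedᵢ))) ⟩
      expand (λ y R → M i y * pf schur N R) T                 ∎
      where
      unshear-step : ∀ P t Q → pf ω (suc N) (eᵢ ∷ P ++ shearedᵢ t ∷ Q) ≈ pf ω (suc N) (eᵢ ∷ P ++ e t ∷ Q)
      unshear-step P t Q = pf-dropᵢ (suc N) (eᵢ ∷ P) Q 1# t (M j t * γ) (pf-repeated (suc N) eᵢ P Q)

module MatrixAlgebra {c ℓ} (F : Field c ℓ) where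
  open import Data.Bool using (if_then_else_)
  open import Data.Nat using (zero; suc)
  open import Data.Fin as Fin using (zero; suc)
  open import Data.Product using (_,_)
  import Relation.Binary.PropositionalEquality as P
  open import Relation.Nullary using (yes; no)
  open Field F hiding (zero)
  open WithField F
  open IntegerCoefficientSolver commutativeRing using (solve; _:=_; _:+_)
  open FinComparisons
  open import Relation.Binary.Reasoning.Setoid setoid

  sumF-cong : ∀ {k} {f g : Fin k → Carrier} → (∀ t → f t ≈ g t) → sumF f ≈ sumF g
  sumF-cong {zero}  e = refl
  sumF-cong {suc k} e = +-cong (e zero) (sumF-cong (λ t → e (suc t)))

  sumF-+ : ∀ {k} (f g : Fin k → Carrier) → sumF (λ t → f t + g t) ≈ sumF f + sumF g
  sumF-+ {zero}  f g = sym (+-identityˡ _)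
  sumF-+ {suc k} f g = trans (+-congˡ (sumF-+ (λ t → f (suc t)) (λ t → g (suc t))))
    (solve 4 (λ a b c d → (a :+ b) :+ (c :+ d) := (a :+ c) :+ (b :+ d)) refl _ _ _ _)

  sumF-*ˡ : ∀ {k} a (f : Fin k → Carrier) → sumF (λ t → a * f t) ≈ a * sumF f
  sumF-*ˡ {zero}  a f = sym (zeroʳ a)
  sumF-*ˡ {suc k} a f = trans (+-congˡ (sumF-*ˡ a (λ t → f (suc t)))) (sym (distribˡ _ _ _))

  sumF-*ʳ : ∀ {k} a (f : Fin k → Carrier) → sumF (λ t → f t * a) ≈ sumF f * a
  sumF-*ʳ a f = trans (sumF-cong (λ t → *-comm (f t) a)) (trans (sumF-*ˡ a f) (*-comm a (sumF f)))

  sumF-0 : ∀ {k} → sumF {k} (λ _ → 0#) ≈ 0#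
  sumF-0 {zero}  = refl
  sumF-0 {suc k} = trans (+-identityˡ _) (sumF-0 {k})

  sumF-swap : ∀ {k m} (f : Fin k → Fin m → Carrier) → sumF (λ t → sumF (λ u → f t u)) ≈ sumF (λ u → sumF (λ t → f t u))
  sumF-swap {zero}  {m} f = sym (sumF-0 {m})
  sumF-swap {suc k} {m} f = begin
    sumF (λ u → f zero u) + sumF (λ t → sumF (λ u → f (suc t) u)) ≈⟨ +-congˡ (sumF-swap (λ t u → f (suc t) u)) ⟩
    sumF (λ u → f zero u) + sumF (λ u → sumF (λ t → f (suc t) u)) ≈⟨ sumF-+ (λ u → f zero u) (λ u → sumF (λ t → f (suc t) u)) ⟨
    sumF (λ u → f zero u + sumF (λ t → f (suc t) u))              ∎

  sumF-δ : ∀ {k} (p : Fin k) (g : Carrier) → sumF (λ t → if t =ᵇ p then g else 0#) ≈ g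
  sumF-δ {suc k} zero g = begin
    (if zero =ᵇ zero {k} then g else 0#) + sumF (λ (t : Fin k) → if suc t =ᵇ zero then g else 0#)
      ≈⟨ +-cong (reflexive (P.cong (λ b → if b then g else 0#) (=ᵇ-refl {suc k} zero)))
                (trans (sumF-cong {k} (λ t → reflexive (P.cong (λ b → if b then g else 0#) (=ᵇ-≢ {x = suc t} {y = zero} (λ ()))))) (sumF-0 {k})) ⟩
    g + 0#  ≈⟨ +-identityʳ _ ⟩
    g       ∎
  sumF-δ {suc k} (suc p) g = begin
    (if zero =ᵇ suc p then g else 0#) + sumF (λ (t : Fin k) → if suc t =ᵇ suc p then g else 0#)
      ≈⟨ +-cong (reflexive (P.cong (λ b → if b then g else 0#) (=ᵇ-≢ {x = zero} {y = suc p} (λ ()))))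
                (trans (sumF-cong (λ t → reflexive (P.cong (λ b → if b then g else 0#) (=ᵇ-suc t p)))) (sumF-δ p g)) ⟩
    0# + g  ≈⟨ +-identityˡ _ ⟩
    g       ∎

  I-*ˡ : ∀ {k} (r t : Fin k) (g : Fin k → Carrier) → I r t * g t ≈ (if t =ᵇ r then g r else 0#)
  I-*ˡ r t g with t Fin.≟ r
  ... | yes P.refl rewrite =ᵇ-refl t = *-identityˡ _
  ... | no t≢r rewrite =ᵇ-≢ (λ r≡t → t≢r (P.sym r≡t)) = zeroˡ _

  I-*ʳ : ∀ {k} (t s : Fin k) (g : Fin k → Carrier) → g t * I t s ≈ (if t =ᵇ s then g s else 0#)
  I-*ʳ t s g with t Fin.≟ s
  ... | yes P.refl = *-identityʳ _
  ... | no _       = zeroʳ _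

  ⊗-identityˡ : ∀ {k m} (M : Mat k m) → (I ⊗ M) ≈ₘ M
  ⊗-identityˡ M r s = trans (sumF-cong (λ t → I-*ˡ r t (λ t → M t s))) (sumF-δ r (M r s))

  ⊗-identityʳ : ∀ {k m} (M : Mat k m) → (M ⊗ I) ≈ₘ M
  ⊗-identityʳ M r s = trans (sumF-cong (λ t → I-*ʳ t s (M r))) (sumF-δ s (M r s))

  ⊗-assoc : ∀ {a b d e} (M : Mat a b) (N : Mat b d) (Q : Mat d e) → ((M ⊗ N) ⊗ Q) ≈ₘ (M ⊗ (N ⊗ Q))
  ⊗-assoc M N Q r s = begin
    sumF (λ t → sumF (λ u → M r u * N u t) * Q t s)   ≈⟨ sumF-cong (λ t → sym (sumF-*ʳ (Q t s) (λ u → M r u * N u t))) ⟩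
    sumF (λ t → sumF (λ u → M r u * N u t * Q t s))   ≈⟨ sumF-swap (λ t u → M r u * N u t * Q t s) ⟩
    sumF (λ u → sumF (λ t → M r u * N u t * Q t s))
      ≈⟨ sumF-cong (λ u → trans (sumF-cong (λ t → *-assoc (M r u) (N u t) (Q t s))) (sumF-*ˡ (M r u) (λ t → N u t * Q t s))) ⟩
    sumF (λ u → M r u * sumF (λ t → N u t * Q t s))   ∎

  ⊗-cong : ∀ {a b d} {M M′ : Mat a b} {N N′ : Mat b d} → M ≈ₘ M′ → N ≈ₘ N′ → (M ⊗ N) ≈ₘ (M′ ⊗ N′)
  ⊗-cong eM eN r s = sumF-cong (λ t → *-cong (eM r t) (eN t s))

  private
    ≈ₘ-trans : ∀ {a b} {M N Q : Mat a b} → M ≈ₘ N → N ≈ₘ Q → M ≈ₘ Q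
    ≈ₘ-trans e₁ e₂ r s = trans (e₁ r s) (e₂ r s)

    ≈ₘ-sym : ∀ {a b} {M N : Mat a b} → M ≈ₘ N → N ≈ₘ M
    ≈ₘ-sym e r s = sym (e r s)

    ≈ₘ-refl : ∀ {a b} {M : Mat a b} → M ≈ₘ M
    ≈ₘ-refl r s = refl

  row-reduction-inverse : ∀ {n} (E L K B : Mat n n) → Invertible E → (E ⊗ L) ≈ₘ B → (E ⊗ K) ≈ₘ I → (K ⊗ B) ≈ₘ L
  row-reduction-inverse E L K B (E′ , E′E≈I , EE′≈I) EL≈B EK≈I =
    ≈ₘ-trans (⊗-cong ≈ₘ-refl (≈ₘ-sym EL≈B)) (≈ₘ-trans (≈ₘ-sym (⊗-assoc K E L))
      (≈ₘ-trans (⊗-cong (≈ₘ-trans (⊗-cong K≈E′ ≈ₘ-refl) E′E≈I) ≈ₘ-refl) (⊗-identityˡ L)))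
    where
    K≈E′ : K ≈ₘ E′
    K≈E′ = ≈ₘ-trans (≈ₘ-sym (⊗-identityˡ K)) (≈ₘ-trans (⊗-cong (≈ₘ-sym E′E≈I) ≈ₘ-refl)
             (≈ₘ-trans (⊗-assoc E′ E K) (≈ₘ-trans (⊗-cong ≈ₘ-refl EK≈I) (⊗-identityʳ E′))))

module Signs where
  open import Data.Bool as Bool using (Bool; true; false; if_then_else_; _∧_; not)
  import Data.Bool.Properties as Bool
  open import Data.Nat as ℕ using (ℕ)
  import Data.Nat.Properties as ℕ
  open import Data.Fin as Fin using (Fin)
  import Data.Fin.Properties as Fin
  open import Data.List as List using (List; []; _∷_; _++_; [_]; filterᵇ; foldr)
  import Data.List.Properties as List
  open import Relation.Binary using (tri<; tri≈; tri>)
  open import Relation.Binary.PropositionalEquality as P using (_≡_)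
  open import Relation.Nullary using (yes; no)
  open import Data.Empty using (⊥-elim)
  open import Data.List.Membership.Propositional using (_∈_)
  open import Data.List.Relation.Unary.Any using (here; there)
  open import Data.List.Relation.Unary.All as All using (All; []; _∷_)
  open import Data.List.Relation.Unary.AllPairs using (AllPairs; []; _∷_)
  open FinComparisons

  delete : ∀ {n} → Fin n → List (Fin n) → List (Fin n)
  delete p []      = []
  delete p (y ∷ L) = if y =ᵇ p then L else y ∷ delete p L

  filterᵇ-cong-on : ∀ {n} {b b′ : Fin n → Bool} {L} → All (λ k → b k ≡ b′ k) L → filterᵇ b L ≡ filterᵇ b′ L
  filterᵇ-cong-on {L = []}    []       = P.refl
  filterᵇ-cong-on {b = b} {b′} {y ∷ L} (e ∷ es) with b y | b′ y | e
  ... | true  | .true  | P.refl = P.cong (y ∷_) (filterᵇ-cong-on es)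
  ... | false | .false | P.refl = filterᵇ-cong-on es

  delete-filterᵇ : ∀ {n} (p : Fin n) (b : Fin n → Bool) L → AllPairs Fin._<_ L →
    delete p (filterᵇ b L) ≡ filterᵇ (λ k → b k ∧ not (k =ᵇ p)) L
  delete-filterᵇ p b []      _              = P.refl
  delete-filterᵇ p b (y ∷ L) (y<L ∷ sorted) with b y
  ... | false = delete-filterᵇ p b L sorted
  ... | true with y Fin.≟ p
  ...   | yes P.refl = filterᵇ-cong-on (All.map
          (λ {k} y<k → P.sym (P.trans (P.cong (λ z → b k ∧ not z) (=ᵇ-≢ (λ k≡y → Fin.<⇒≢ y<k (P.sym k≡y)))) (Bool.∧-identityʳ (b k)))) y<L)
  ...   | no _       = P.cong (y ∷_) (delete-filterᵇ p b L sorted)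

  module Products {c ℓ} (R : CommutativeRing c ℓ) where
    open CommutativeRing R
    open Expansion R
    open IntegerCoefficientSolver R using (solve; _:=_; _:*_; :-_; :1)
    open import Relation.Binary.Reasoning.Setoid setoid

    prodL : ∀ {X : Set} → (X → Carrier) → List X → Carrier
    prodL w = foldr (λ k acc → w k * acc) 1#

    module _ {X : Set} where
      prodL-filterᵇ : ∀ (w : X → Carrier) (b : X → Bool) L → prodL w (filterᵇ b L) ≈ prodL (λ k → if b k then w k else 1#) L
      prodL-filterᵇ w b []      = refl
      prodL-filterᵇ w b (y ∷ L) with b y
      ... | true  = *-congˡ (prodL-filterᵇ w b L)
      ... | false = trans (prodL-filterᵇ w b L) (sym (*-identityˡ _))

      prodL-* : ∀ (f g : X → Carrier) L → prodL (λ k → f k * g k) L ≈ prodL f L * prodL g L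
      prodL-* f g []      = sym (*-identityˡ 1#)
      prodL-* f g (y ∷ L) = trans (*-congˡ (prodL-* f g L))
        (solve 4 (λ a b c d → (a :* b) :* (c :* d) := (a :* c) :* (b :* d)) refl _ _ _ _)

      prodL-cong : ∀ {f g : X → Carrier} L → (∀ k → f k ≈ g k) → prodL f L ≈ prodL g L
      prodL-cong []      e = refl
      prodL-cong (y ∷ L) e = *-cong (e y) (prodL-cong L e)

      prodL-1 : ∀ {f : X → Carrier} {L} → All (λ k → f k ≈ 1#) L → prodL f L ≈ 1#
      prodL-1 []       = refl
      prodL-1 (e ∷ es) = trans (*-cong e (prodL-1 es)) (*-identityˡ 1#)

      Pick-prodL : ∀ (w : X → Carrier) {y R L} → Pick y R L → w y * prodL w R ≈ prodL w L
      Pick-prodL w first = refl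
      Pick-prodL w {y} (later {z = z} {R = R} p) =
        trans (solve 3 (λ a b c → a :* (b :* c) := b :* (a :* c)) refl (w y) (w z) (prodL w R)) (*-congˡ (Pick-prodL w p))

      pf-scale : ∀ (d : X → Carrier) (M : X → X → Carrier) N L →
        pf (λ k l → d k * (d l * M k l)) N L ≈ prodL d L * pf M N L
      pf-scale d M N             []      = sym (*-identityˡ 1#)
      pf-scale d M ℕ.zero        (x ∷ L) = sym (zeroʳ _)
      pf-scale d M (ℕ.suc N)     (x ∷ L) = begin
        expand (λ y R → (d x * (d y * M x y)) * pf (λ k l → d k * (d l * M k l)) N R) L
          ≈⟨ expand-cong-on L (λ y R p → trans (*-congˡ (pf-scale d M N R))
               (trans (solve 5 (λ a b m p q → (a :* (b :* m)) :* (p :* q) := a :* ((b :* p) :* (m :* q))) refl (d x) (d y) (M x y) (prodL d R) (pf M N R))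
                  (*-congˡ (*-congʳ (Pick-prodL d p))))) ⟩
        expand (λ y R → d x * (prodL d L * (M x y * pf M N R))) L ≈⟨ expand-cong L (λ y R → sym (*-assoc _ _ _)) ⟩
        expand (λ y R → (d x * prodL d L) * (M x y * pf M N R)) L ≈⟨ expand-* _ (λ y R → M x y * pf M N R) L ⟩
        (d x * prodL d L) * expand (λ y R → M x y * pf M N R) L   ∎

    module _ {n : ℕ} where
      prodL-δ : ∀ (p : Fin n) (x : Carrier) L → AllPairs Fin._<_ L → p ∈ L → prodL (λ k → if k =ᵇ p then x else 1#) L ≈ x
      prodL-δ p x (y ∷ L) (y<L ∷ _) (here P.refl) rewrite =ᵇ-refl y = trans
        (*-congˡ (prodL-1 (All.map (λ {k} y<k → reflexive (P.cong (λ z → if z then x else 1#) (=ᵇ-≢ (λ k≡y → Fin.<⇒≢ y<k (P.sym k≡y))))) y<L)))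
        (*-identityʳ x)
      prodL-δ p x (y ∷ L) (y<L ∷ sorted) (there p∈L) rewrite =ᵇ-≢ (Fin.<⇒≢ (All.lookup y<L p∈L)) =
        trans (*-identityˡ _) (prodL-δ p x L sorted p∈L)

      -- crossingSign p L is the sign of moving p to the front of the increasing list L.
      sideSign : Fin n → Fin n → Carrier
      sideSign p k = if k <ᵇ p then - 1# else 1#

      crossingSign : Fin n → List (Fin n) → Carrier
      crossingSign p = prodL (sideSign p)

      sideSign² : ∀ (p k : Fin n) → sideSign p k * sideSign p k ≈ 1#
      sideSign² p k with k <ᵇ p
      ... | true  = solve 0 ((:- :1) :* (:- :1) := :1) refl
      ... | false = *-identityˡ 1#

      crossingSign² : ∀ (p : Fin n) L → crossingSign p L * crossingSign p L ≈ 1#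
      crossingSign² p L = trans (sym (prodL-* (sideSign p) (sideSign p) L)) (prodL-1 {L = L} (All.tabulate (λ {k} _ → sideSign² p k)))

      sideSign-above : ∀ {p k : Fin n} → p Fin.< k → sideSign p k ≡ 1#
      sideSign-above p<k rewrite <ᵇ-false (ℕ.<⇒≤ p<k) = P.refl

      sideSign-self : ∀ (p : Fin n) → sideSign p p ≡ 1#
      sideSign-self p rewrite <ᵇ-false (Fin.≤-refl {x = p}) = P.refl

      sideSign-below : ∀ {p k : Fin n} → k Fin.< p → sideSign p k ≡ - 1#
      sideSign-below k<p rewrite <ᵇ-true k<p = P.refl

      flipSign≈sideSigns : ∀ (i j : Fin n) → i Fin.< j → ∀ k → (if (i ≤ᵇ k) ∧ (k <ᵇ j) then - 1# else 1#) ≈ sideSign i k * sideSign j k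
      flipSign≈sideSigns i j i<j k with Fin.<-cmp k i
      ... | tri< k<i _ _ rewrite ≤ᵇ-false k<i | <ᵇ-true k<i | <ᵇ-true (Fin.<-trans k<i i<j) =
        solve 0 (:1 := (:- :1) :* (:- :1)) refl
      ... | tri≈ _ P.refl _ rewrite ≤ᵇ-true (Fin.≤-refl {x = k}) | <ᵇ-false (Fin.≤-refl {x = k}) | <ᵇ-true i<j =
        sym (*-identityˡ _)
      ... | tri> _ _ i<k rewrite ≤ᵇ-true (ℕ.<⇒≤ i<k) | <ᵇ-false (ℕ.<⇒≤ i<k) with Fin.<-cmp k j
      ...   | tri< k<j _ _ rewrite <ᵇ-true k<j = sym (*-identityˡ _)
      ...   | tri≈ _ P.refl _ rewrite <ᵇ-false (Fin.≤-refl {x = k}) = sym (*-identityˡ _)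
      ...   | tri> _ _ j<k rewrite <ᵇ-false (ℕ.<⇒≤ j<k) = sym (*-identityˡ _)

      module _ (M : Fin n → Fin n → Carrier) (skew : ∀ a b → M a b ≈ - M b a) (alt : ∀ a → M a a ≈ 0#) where
        open Alternating M skew alt

        pf-pull-front : ∀ N W (p : Fin n) L → AllPairs Fin._<_ L → p ∈ L →
          pf M N (W ++ L) ≈ crossingSign p L * pf M N (W ++ p ∷ delete p L)
        pf-pull-front N W p (y ∷ L) (y<L ∷ sorted) p∈ with y Fin.≟ p
        ... | yes P.refl rewrite sideSign-self y =
          sym (trans (*-congʳ (trans (*-identityˡ _) (prodL-1 (All.map (λ y<k → reflexive (sideSign-above y<k)) y<L)))) (*-identityˡ _))
        ... | no y≢p with p∈
        ...   | here p≡y     = ⊥-elim (y≢p (P.sym p≡y))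
        ...   | there p∈L rewrite sideSign-below {p = p} {k = y} (All.lookup y<L p∈L) = begin
          pf M N (W ++ y ∷ L)                              ≡⟨ P.cong (pf M N) (P.sym (List.++-assoc W [ y ] L)) ⟩
          pf M N ((W ++ [ y ]) ++ L)                       ≈⟨ pf-pull-front N (W ++ [ y ]) p L sorted p∈L ⟩
          σ * pf M N ((W ++ [ y ]) ++ p ∷ delete p L)     ≡⟨ P.cong (λ z → σ * pf M N z) (List.++-assoc W [ y ] (p ∷ delete p L)) ⟩
          σ * pf M N (W ++ y ∷ p ∷ delete p L)            ≈⟨ *-congˡ (pf-swap N W y p (delete p L)) ⟩
          σ * - pf M N (W ++ p ∷ y ∷ delete p L)          ≈⟨ solve 2 (λ d q → d :* (:- q) := ((:- :1) :* d) :* q) refl _ _ ⟩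
          (- 1# * σ) * pf M N (W ++ p ∷ y ∷ delete p L)   ∎
          where
          σ : Carrier
          σ = crossingSign p L

module PivotedMatrix {c ℓ} (F : Field c ℓ) (n : ℕ) (A : WithField.Mat F n n) (skA : WithField.SkewSymmetric F A)
  (i j : Fin n) (i<j : i < j) (nz : ¬ (Field._≈_ F (A i j) (Field.0# F)))
  (E B : WithField.Mat F n n) (invE : WithField.Invertible F E)
  (reduces : WithField._≈ₘ_ F (WithField._⊗_ F E (WithField.swapped F A i j)) (WithField.augment F B (WithField.I F))) where
  open import Data.Bool as Bool using (Bool; true; false; if_then_else_; _∧_; _∨_; not; _xor_)
  import Data.Bool.Properties as Bool
  open import Data.Empty using (⊥)
  open import Data.Nat as ℕ using (suc; _≤_)
  import Data.Nat.Properties as ℕ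
  open import Data.Fin as Fin using (_↑ˡ_; _↑ʳ_)
  import Data.Fin.Properties as Fin
  open import Data.List using (List; []; _∷_; [_]; filterᵇ; allFin)
  open import Data.List.Membership.Propositional using (_∈_)
  open import Data.List.Membership.Propositional.Properties using (∈-filter⁺; ∈-filter⁻; ∈-allFin)
  open import Data.List.Relation.Unary.All as All using ()
  open import Data.List.Relation.Unary.AllPairs using (AllPairs)
  import Data.List.Relation.Unary.AllPairs.Properties as AllPairs
  open import Data.Product using (_×_; _,_; proj₁; proj₂)
  import Function
  open import Relation.Binary.PropositionalEquality as P using (_≡_; _≢_)
  open import Relation.Nullary using (yes; no)
  open import Relation.Nullary.Decidable using (T?)
  import Data.Vec as Vec
  import Data.Vec.Properties as Vec
  open Field F hiding (zero)
  open WithField F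
  open Expansion commutativeRing
  open PermutationSums F using (allFin-sorted; length-filterᵇ-allFin)
  open MatrixAlgebra F
  open FinComparisons
  open Signs
  open Signs.Products commutativeRing
  open IntegerCoefficientSolver commutativeRing using (solve; _:=_; _:+_; _:*_; :-_; :0; :1)
  open import Algebra.Properties.Ring ring using (-0#≈0#; -‿involutive)
  open import Relation.Binary.Reasoning.Setoid setoid

  skew : ∀ k l → A k l ≈ - A l k
  skew = proj₁ skA

  alt : ∀ k → A k k ≈ 0#
  alt = proj₂ skA

  γ : Carrier
  γ = inv (A i j) nz

  γ-inv : γ * A i j ≈ 1#
  γ-inv = trans (*-comm _ _) (inv-law (A i j) nz)

  i≢j : i ≢ j
  i≢j = Fin.<⇒≢ i<j

  j≢i : j ≢ i
  j≢i j≡i = i≢j (P.sym j≡i)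

  open Pivoting.Pivot commutativeRing A skew alt i j γ γ-inv public using (schur; cancel-γ; pf-pivots-head; pf-pivotᵢ-head; pf-pivotⱼ-head)

  isPivot : Fin n → Bool
  isPivot k = (k =ᵇ i) ∨ (k =ᵇ j)

  data PivotCase (k : Fin n) : Set where
    at-i      : k ≡ i → PivotCase k
    at-j      : k ≡ j → PivotCase k
    off-pivot : k ≢ i → k ≢ j → PivotCase k

  pivotCase : ∀ k → PivotCase k
  pivotCase k with k Fin.≟ i | k Fin.≟ j
  ... | yes k≡i | _       = at-i k≡i
  ... | no _    | yes k≡j = at-j k≡j
  ... | no k≢i  | no k≢j  = off-pivot k≢i k≢j

  private
    if-true : ∀ {b} {x y : Carrier} → b ≡ true → (if b then x else y) ≡ x
    if-true P.refl = P.refl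

    if-false : ∀ {b} {x y : Carrier} → b ≡ false → (if b then x else y) ≡ y
    if-false P.refl = P.refl

  isPivot-i : isPivot i ≡ true
  isPivot-i rewrite =ᵇ-refl i = P.refl

  isPivot-j : isPivot j ≡ true
  isPivot-j rewrite =ᵇ-≢ j≢i | =ᵇ-refl j = P.refl

  isPivot-off : ∀ {k} → k ≢ i → k ≢ j → isPivot k ≡ false
  isPivot-off k≢i k≢j rewrite =ᵇ-≢ k≢i | =ᵇ-≢ k≢j = P.refl

  I-diag : ∀ r → I {n} r r ≡ 1#
  I-diag r = if-true (=ᵇ-refl r)

  I-off : ∀ {r l : Fin n} → r ≢ l → I {n} r l ≡ 0#
  I-off r≢l = if-false (=ᵇ-≢ r≢l)

  -- The two n × n blocks of the matrix (A, I) after the column interchanges.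
  Aˢ Iˢ : Mat n n
  Aˢ r k = if isPivot k then I r k else A r k
  Iˢ r k = if isPivot k then A r k else I r k

  Aˢ-pivot : ∀ r {k} → isPivot k ≡ true → Aˢ r k ≡ I r k
  Aˢ-pivot r = if-true

  Aˢ-off : ∀ r {l} → l ≢ i → l ≢ j → Aˢ r l ≡ A r l
  Aˢ-off r l≢i l≢j = if-false (isPivot-off l≢i l≢j)

  private
    swapped-left : ∀ t k → swapped A i j t (k ↑ˡ n) ≡ Aˢ t k
    swapped-left t k rewrite Fin.splitAt-↑ˡ n k n with isPivot k
    ... | true  rewrite Fin.splitAt-↑ʳ n n k = P.refl
    ... | false rewrite Fin.splitAt-↑ˡ n k n = P.refl

    swapped-right : ∀ t k → swapped A i j t (n ↑ʳ k) ≡ Iˢ t k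
    swapped-right t k rewrite Fin.splitAt-↑ʳ n n k with isPivot k
    ... | true  rewrite Fin.splitAt-↑ˡ n k n = P.refl
    ... | false rewrite Fin.splitAt-↑ʳ n n k = P.refl

    augment-left : ∀ r k → augment B I r (k ↑ˡ n) ≡ B r k
    augment-left r k rewrite Fin.splitAt-↑ˡ n k n = P.refl

    augment-right : ∀ r k → augment B I r (n ↑ʳ k) ≡ I r k
    augment-right r k rewrite Fin.splitAt-↑ʳ n n k = P.refl

  E⊗Aˢ≈B : (E ⊗ Aˢ) ≈ₘ B
  E⊗Aˢ≈B r k = trans (sumF-cong (λ t → *-congˡ (reflexive (P.sym (swapped-left t k)))))
                     (trans (reduces r (k ↑ˡ n)) (reflexive (augment-left r k)))

  E⊗Iˢ≈I : (E ⊗ Iˢ) ≈ₘ I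
  E⊗Iˢ≈I r k = trans (sumF-cong (λ t → *-congˡ (reflexive (P.sym (swapped-right t k)))))
                     (trans (reduces r (n ↑ʳ k)) (reflexive (augment-right r k)))

  offPivotRow : Fin n → Fin n → Carrier
  offPivotRow r s = if isPivot r then 0# else B r s

  private
    no-pivot-row : ∀ p r s → isPivot p ≡ true → (if p =ᵇ r then offPivotRow r s else 0#) ≈ 0#
    no-pivot-row p r s pivot with p Fin.≟ r
    ... | yes P.refl = reflexive (if-true pivot)
    ... | no _       = refl

  Iˢ-*-B : ∀ r s t → Iˢ r t * B t s ≈
    (if t =ᵇ i then A r i * B i s else 0#) + ((if t =ᵇ j then A r j * B j s else 0#) + (if t =ᵇ r then offPivotRow r s else 0#))
  Iˢ-*-B r s t with pivotCase t
  ... | at-i P.refl = begin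
    Iˢ r i * B i s   ≡⟨ P.cong (_* B i s) (if-true isPivot-i) ⟩
    A r i * B i s
      ≈⟨ sym (trans (+-cong (reflexive (if-true (=ᵇ-refl i))) (trans (+-cong (reflexive (if-false (=ᵇ-≢ i≢j))) (no-pivot-row i r s isPivot-i)) (+-identityˡ 0#))) (+-identityʳ _)) ⟩
    _ + (_ + _)      ∎
  ... | at-j P.refl = begin
    Iˢ r j * B j s   ≡⟨ P.cong (_* B j s) (if-true isPivot-j) ⟩
    A r j * B j s
      ≈⟨ sym (trans (+-cong (reflexive (if-false (=ᵇ-≢ j≢i))) (+-cong (reflexive (if-true (=ᵇ-refl j))) (no-pivot-row j r s isPivot-j))) (trans (+-identityˡ _) (+-identityʳ _))) ⟩
    _ + (_ + _)      ∎
  ... | off-pivot t≢i t≢j with t Fin.≟ r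
  ...   | yes P.refl = begin
    Iˢ t t * B t s   ≡⟨ P.cong (_* B t s) (P.trans (if-false (isPivot-off t≢i t≢j)) (I-diag t)) ⟩
    1# * B t s       ≈⟨ *-identityˡ _ ⟩
    B t s            ≡⟨ if-false (isPivot-off t≢i t≢j) ⟨
    offPivotRow t s
      ≈⟨ sym (trans (+-cong (reflexive (if-false (=ᵇ-≢ t≢i))) (+-cong (reflexive (if-false (=ᵇ-≢ t≢j))) refl)) (trans (+-identityˡ _) (+-identityˡ _))) ⟩
    _ + (_ + _)      ∎
  ...   | no t≢r = begin
    Iˢ r t * B t s   ≡⟨ P.cong (_* B t s) (P.trans (if-false (isPivot-off t≢i t≢j)) (I-off (λ r≡t → t≢r (P.sym r≡t)))) ⟩
    0# * B t s       ≈⟨ zeroˡ _ ⟩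
    0#
      ≈⟨ sym (trans (+-cong (reflexive (if-false (=ᵇ-≢ t≢i))) (+-cong (reflexive (if-false (=ᵇ-≢ t≢j))) refl)) (trans (+-identityˡ _) (+-identityˡ _))) ⟩
    _ + (_ + _)      ∎

  row-equation : ∀ r s → A r i * B i s + (A r j * B j s + offPivotRow r s) ≈ Aˢ r s
  row-equation r s = begin
    A r i * B i s + (A r j * B j s + offPivotRow r s)  ≈⟨ +-cong (sumF-δ i _) (+-cong (sumF-δ j _) (sumF-δ r _)) ⟨
    sumF δᵢ + (sumF δⱼ + sumF δᵣ)                      ≈⟨ trans (sumF-+ δᵢ (λ t → δⱼ t + δᵣ t)) (+-congˡ (sumF-+ δⱼ δᵣ)) ⟨
    sumF (λ t → δᵢ t + (δⱼ t + δᵣ t))                  ≈⟨ sumF-cong (Iˢ-*-B r s) ⟨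
    (Iˢ ⊗ B) r s                                       ≈⟨ row-reduction-inverse E Aˢ Iˢ B invE E⊗Aˢ≈B E⊗Iˢ≈I r s ⟩
    Aˢ r s                                             ∎
    where
    δᵢ δⱼ δᵣ : Fin n → Carrier
    δᵢ t = if t =ᵇ i then A r i * B i s else 0#
    δⱼ t = if t =ᵇ j then A r j * B j s else 0#
    δᵣ t = if t =ᵇ r then offPivotRow r s else 0#

  B-row-j : ∀ s → B j s ≈ γ * Aˢ i s
  B-row-j s = begin
    B j s                  ≈⟨ trans (*-congʳ γ-inv) (*-identityˡ _) ⟨
    γ * A i j * B j s      ≈⟨ *-assoc _ _ _ ⟩
    γ * (A i j * B j s)
      ≈⟨ *-congˡ (sym (trans (+-cong (trans (*-congʳ (alt i)) (zeroˡ _)) (+-congˡ (reflexive (if-true isPivot-i)))) (trans (+-identityˡ _) (+-identityʳ _)))) ⟩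
    γ * (A i i * B i s + (A i j * B j s + offPivotRow i s)) ≈⟨ *-congˡ (row-equation i s) ⟩
    γ * Aˢ i s             ∎

  B-row-i : ∀ s → B i s ≈ - (γ * Aˢ j s)
  B-row-i s = begin
    B i s                  ≈⟨ trans (*-congʳ γ-inv) (*-identityˡ _) ⟨
    γ * A i j * B i s      ≈⟨ solve 3 (λ c a b → c :* a :* b := :- (c :* ((:- a) :* b :+ (:0 :+ :0)))) refl γ (A i j) (B i s) ⟩
    - (γ * (- A i j * B i s + (0# + 0#)))
      ≈⟨ -‿cong (*-congˡ (+-cong (*-congʳ (sym (skew j i))) (+-cong (sym (trans (*-congʳ (alt j)) (zeroˡ _))) (sym (reflexive (if-true isPivot-j)))))) ⟩
    - (γ * (A j i * B i s + (A j j * B j s + offPivotRow j s))) ≈⟨ -‿cong (*-congˡ (row-equation j s)) ⟩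
    - (γ * Aˢ j s)         ∎

  B-row-off : ∀ r s → r ≢ i → r ≢ j → B r s ≈ Aˢ r s + - (A r i * B i s) + - (A r j * B j s)
  B-row-off r s r≢i r≢j = begin
    B r s  ≈⟨ solve 3 (λ x y z → z := (x :+ (y :+ z)) :+ (:- x) :+ (:- y)) refl (A r i * B i s) (A r j * B j s) (B r s) ⟩
    (A r i * B i s + (A r j * B j s + B r s)) + - (A r i * B i s) + - (A r j * B j s)
      ≈⟨ +-congʳ (+-congʳ (trans (+-congˡ (+-congˡ (reflexive (P.sym (if-false (isPivot-off r≢i r≢j)))))) (row-equation r s))) ⟩
    Aˢ r s + - (A r i * B i s) + - (A r j * B j s) ∎

  -- The closed form of B = Iˢ⁻¹ ⊗ Aˢ.
  B̂ : Mat n n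
  B̂ k l =
    if k =ᵇ i then (if l =ᵇ i then 0# else if l =ᵇ j then - γ else - (γ * A j l))
    else if k =ᵇ j then (if l =ᵇ i then γ else if l =ᵇ j then 0# else γ * A i l)
    else (if l =ᵇ i then - (γ * A k j) else if l =ᵇ j then γ * A k i else schur k l)

  B̂ᵢᵢ : B̂ i i ≡ 0#
  B̂ᵢᵢ = P.trans (if-true (=ᵇ-refl i)) (if-true (=ᵇ-refl i))

  B̂ᵢⱼ : B̂ i j ≡ - γ
  B̂ᵢⱼ = P.trans (if-true (=ᵇ-refl i)) (P.trans (if-false (=ᵇ-≢ j≢i)) (if-true (=ᵇ-refl j)))

  B̂ᵢ-off : ∀ {l} → l ≢ i → l ≢ j → B̂ i l ≡ - (γ * A j l)
  B̂ᵢ-off l≢i l≢j = P.trans (if-true (=ᵇ-refl i)) (P.trans (if-false (=ᵇ-≢ l≢i)) (if-false (=ᵇ-≢ l≢j)))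

  private
    B̂-row-j : ∀ l → B̂ j l ≡ (if l =ᵇ i then γ else if l =ᵇ j then 0# else γ * A i l)
    B̂-row-j l = P.trans (if-false (=ᵇ-≢ j≢i)) (if-true (=ᵇ-refl j))

    B̂-row-off : ∀ {k} l → k ≢ i → k ≢ j → B̂ k l ≡ (if l =ᵇ i then - (γ * A k j) else if l =ᵇ j then γ * A k i else schur k l)
    B̂-row-off l k≢i k≢j = P.trans (if-false (=ᵇ-≢ k≢i)) (if-false (=ᵇ-≢ k≢j))

  B̂ⱼᵢ : B̂ j i ≡ γ
  B̂ⱼᵢ = P.trans (B̂-row-j i) (if-true (=ᵇ-refl i))

  B̂ⱼⱼ : B̂ j j ≡ 0#
  B̂ⱼⱼ = P.trans (B̂-row-j j) (P.trans (if-false (=ᵇ-≢ j≢i)) (if-true (=ᵇ-refl j)))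

  B̂ⱼ-off : ∀ {l} → l ≢ i → l ≢ j → B̂ j l ≡ γ * A i l
  B̂ⱼ-off {l} l≢i l≢j = P.trans (B̂-row-j l) (P.trans (if-false (=ᵇ-≢ l≢i)) (if-false (=ᵇ-≢ l≢j)))

  B̂-offᵢ : ∀ {k} → k ≢ i → k ≢ j → B̂ k i ≡ - (γ * A k j)
  B̂-offᵢ k≢i k≢j = P.trans (B̂-row-off i k≢i k≢j) (if-true (=ᵇ-refl i))

  B̂-offⱼ : ∀ {k} → k ≢ i → k ≢ j → B̂ k j ≡ γ * A k i
  B̂-offⱼ k≢i k≢j = P.trans (B̂-row-off j k≢i k≢j) (P.trans (if-false (=ᵇ-≢ j≢i)) (if-true (=ᵇ-refl j)))

  B̂-off-off : ∀ {k l} → k ≢ i → k ≢ j → l ≢ i → l ≢ j → B̂ k l ≡ schur k l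
  B̂-off-off {k} {l} k≢i k≢j l≢i l≢j = P.trans (B̂-row-off l k≢i k≢j) (P.trans (if-false (=ᵇ-≢ l≢i)) (if-false (=ᵇ-≢ l≢j)))

  private
    Aˢᵢ : ∀ r → Aˢ r i ≡ I r i
    Aˢᵢ r = Aˢ-pivot r isPivot-i

    Aˢⱼ : ∀ r → Aˢ r j ≡ I r j
    Aˢⱼ r = Aˢ-pivot r isPivot-j

  B≈B̂-row-i : ∀ l → B i l ≈ B̂ i l
  B≈B̂-row-i l with pivotCase l
  ... | at-i P.refl = begin
    B i i               ≈⟨ B-row-i i ⟩
    - (γ * Aˢ j i)      ≡⟨ P.cong (λ z → - (γ * z)) (P.trans (Aˢᵢ j) (I-off j≢i)) ⟩
    - (γ * 0#)          ≈⟨ solve 1 (λ c → :- (c :* :0) := :0) refl γ ⟩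
    0#                  ≡⟨ B̂ᵢᵢ ⟨
    B̂ i i               ∎
  ... | at-j P.refl = begin
    B i j               ≈⟨ B-row-i j ⟩
    - (γ * Aˢ j j)      ≡⟨ P.cong (λ z → - (γ * z)) (P.trans (Aˢⱼ j) (I-diag j)) ⟩
    - (γ * 1#)          ≈⟨ -‿cong (*-identityʳ γ) ⟩
    - γ                 ≡⟨ B̂ᵢⱼ ⟨
    B̂ i j               ∎
  ... | off-pivot l≢i l≢j = trans (B-row-i l) (reflexive (P.trans (P.cong (λ z → - (γ * z)) (Aˢ-off j l≢i l≢j)) (P.sym (B̂ᵢ-off l≢i l≢j))))

  B≈B̂-row-j : ∀ l → B j l ≈ B̂ j l
  B≈B̂-row-j l with pivotCase l
  ... | at-i P.refl = begin
    B j i         ≈⟨ B-row-j i ⟩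
    γ * Aˢ i i    ≡⟨ P.cong (γ *_) (P.trans (Aˢᵢ i) (I-diag i)) ⟩
    γ * 1#        ≈⟨ *-identityʳ γ ⟩
    γ             ≡⟨ B̂ⱼᵢ ⟨
    B̂ j i         ∎
  ... | at-j P.refl = begin
    B j j         ≈⟨ B-row-j j ⟩
    γ * Aˢ i j    ≡⟨ P.cong (γ *_) (P.trans (Aˢⱼ i) (I-off i≢j)) ⟩
    γ * 0#        ≈⟨ zeroʳ γ ⟩
    0#            ≡⟨ B̂ⱼⱼ ⟨
    B̂ j j         ∎
  ... | off-pivot l≢i l≢j = trans (B-row-j l) (reflexive (P.trans (P.cong (γ *_) (Aˢ-off i l≢i l≢j)) (P.sym (B̂ⱼ-off l≢i l≢j))))

  B≈B̂-row-off : ∀ {k} l → k ≢ i → k ≢ j → B k l ≈ B̂ k l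
  B≈B̂-row-off {k} l k≢i k≢j with pivotCase l
  ... | at-i P.refl = begin
    B k i                                         ≈⟨ B-row-off k i k≢i k≢j ⟩
    Aˢ k i + - (A k i * B i i) + - (A k j * B j i)
      ≈⟨ +-cong (+-cong (reflexive (P.trans (Aˢᵢ k) (I-off k≢i))) (-‿cong (*-congˡ (trans (B≈B̂-row-i i) (reflexive B̂ᵢᵢ))))) (-‿cong (*-congˡ (trans (B≈B̂-row-j i) (reflexive B̂ⱼᵢ)))) ⟩
    0# + - (A k i * 0#) + - (A k j * γ)           ≈⟨ solve 3 (λ x y c → :0 :+ (:- (x :* :0)) :+ (:- (y :* c)) := :- (c :* y)) refl (A k i) (A k j) γ ⟩
    - (γ * A k j)                                 ≡⟨ B̂-offᵢ k≢i k≢j ⟨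
    B̂ k i                                         ∎
  ... | at-j P.refl = begin
    B k j                                         ≈⟨ B-row-off k j k≢i k≢j ⟩
    Aˢ k j + - (A k i * B i j) + - (A k j * B j j)
      ≈⟨ +-cong (+-cong (reflexive (P.trans (Aˢⱼ k) (I-off k≢j))) (-‿cong (*-congˡ (trans (B≈B̂-row-i j) (reflexive B̂ᵢⱼ))))) (-‿cong (*-congˡ (trans (B≈B̂-row-j j) (reflexive B̂ⱼⱼ)))) ⟩
    0# + - (A k i * - γ) + - (A k j * 0#)         ≈⟨ solve 3 (λ x y c → :0 :+ (:- (x :* (:- c))) :+ (:- (y :* :0)) := c :* x) refl (A k i) (A k j) γ ⟩
    γ * A k i                                     ≡⟨ B̂-offⱼ k≢i k≢j ⟨
    B̂ k j                                         ∎
  ... | off-pivot l≢i l≢j = begin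
    B k l                                         ≈⟨ B-row-off k l k≢i k≢j ⟩
    Aˢ k l + - (A k i * B i l) + - (A k j * B j l)
      ≈⟨ +-cong (+-cong (reflexive (Aˢ-off k l≢i l≢j)) (-‿cong (*-congˡ (trans (B≈B̂-row-i l) (reflexive (B̂ᵢ-off l≢i l≢j))))))
                (-‿cong (*-congˡ (trans (B≈B̂-row-j l) (reflexive (B̂ⱼ-off l≢i l≢j))))) ⟩
    A k l + - (A k i * - (γ * A j l)) + - (A k j * (γ * A i l))
      ≈⟨ solve 6 (λ kl ki kj jl il c → kl :+ (:- (ki :* (:- (c :* jl)))) :+ (:- (kj :* (c :* il))) := kl :+ (ki :* jl :+ (:- (kj :* il))) :* c)
           refl (A k l) (A k i) (A k j) (A j l) (A i l) γ ⟩
    schur k l                                     ≡⟨ B̂-off-off k≢i k≢j l≢i l≢j ⟨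
    B̂ k l                                         ∎

  B≈B̂ : ∀ k l → B k l ≈ B̂ k l
  B≈B̂ k l with pivotCase k
  ... | at-i P.refl          = B≈B̂-row-i l
  ... | at-j P.refl          = B≈B̂-row-j l
  ... | off-pivot k≢i k≢j    = B≈B̂-row-off l k≢i k≢j

  B̂-skew : ∀ k l → B̂ k l ≈ - B̂ l k
  B̂-skew k l with pivotCase k | pivotCase l
  ... | at-i P.refl | at-i P.refl = trans (reflexive B̂ᵢᵢ) (trans (sym -0#≈0#) (-‿cong (reflexive (P.sym B̂ᵢᵢ))))
  ... | at-i P.refl | at-j P.refl = trans (reflexive B̂ᵢⱼ) (-‿cong (reflexive (P.sym B̂ⱼᵢ)))
  ... | at-j P.refl | at-i P.refl = trans (reflexive B̂ⱼᵢ) (trans (sym (-‿involutive γ)) (-‿cong (reflexive (P.sym B̂ᵢⱼ))))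
  ... | at-j P.refl | at-j P.refl = trans (reflexive B̂ⱼⱼ) (trans (sym -0#≈0#) (-‿cong (reflexive (P.sym B̂ⱼⱼ))))
  ... | at-i P.refl | off-pivot l≢i l≢j = begin
    B̂ i l              ≡⟨ B̂ᵢ-off l≢i l≢j ⟩
    - (γ * A j l)      ≈⟨ -‿cong (*-congˡ (skew j l)) ⟩
    - (γ * - A l j)    ≈⟨ solve 2 (λ c x → :- (c :* (:- x)) := :- (:- (c :* x))) refl γ (A l j) ⟩
    - (- (γ * A l j))  ≡⟨ P.cong -_ (B̂-offᵢ l≢i l≢j) ⟨
    - B̂ l i            ∎
  ... | at-j P.refl | off-pivot l≢i l≢j = begin
    B̂ j l              ≡⟨ B̂ⱼ-off l≢i l≢j ⟩
    γ * A i l          ≈⟨ *-congˡ (skew i l) ⟩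
    γ * - A l i        ≈⟨ solve 2 (λ c x → c :* (:- x) := :- (c :* x)) refl γ (A l i) ⟩
    - (γ * A l i)      ≡⟨ P.cong -_ (B̂-offⱼ l≢i l≢j) ⟨
    - B̂ l j            ∎
  ... | off-pivot k≢i k≢j | at-i P.refl = begin
    B̂ k i              ≡⟨ B̂-offᵢ k≢i k≢j ⟩
    - (γ * A k j)      ≈⟨ -‿cong (*-congˡ (skew k j)) ⟩
    - (γ * - A j k)    ≈⟨ solve 2 (λ c x → :- (c :* (:- x)) := :- (:- (c :* x))) refl γ (A j k) ⟩
    - (- (γ * A j k))  ≡⟨ P.cong -_ (B̂ᵢ-off k≢i k≢j) ⟨
    - B̂ i k            ∎
  ... | off-pivot k≢i k≢j | at-j P.refl = begin
    B̂ k j              ≡⟨ B̂-offⱼ k≢i k≢j ⟩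
    γ * A k i          ≈⟨ *-congˡ (skew k i) ⟩
    γ * - A i k        ≈⟨ solve 2 (λ c x → c :* (:- x) := :- (c :* x)) refl γ (A i k) ⟩
    - (γ * A i k)      ≡⟨ P.cong -_ (B̂ⱼ-off k≢i k≢j) ⟨
    - B̂ j k            ∎
  ... | off-pivot k≢i k≢j | off-pivot l≢i l≢j = begin
    B̂ k l              ≡⟨ B̂-off-off k≢i k≢j l≢i l≢j ⟩
    A k l + (A k i * A j l + - (A k j * A i l)) * γ
      ≈⟨ +-cong (skew k l) (*-congʳ (+-cong (*-cong (skew k i) (skew j l)) (-‿cong (*-cong (skew k j) (skew i l))))) ⟩
    - A l k + (- A i k * - A l j + - (- A j k * - A l i)) * γ
      ≈⟨ solve 6 (λ lk ik lj jk li c → (:- lk) :+ ((:- ik) :* (:- lj) :+ (:- ((:- jk) :* (:- li)))) :* c := :- (lk :+ (li :* jk :+ (:- (lj :* ik))) :* c))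
           refl (A l k) (A i k) (A l j) (A j k) (A l i) γ ⟩
    - (A l k + (A l i * A j k + - (A l j * A i k)) * γ) ≡⟨ P.cong -_ (B̂-off-off l≢i l≢j k≢i k≢j) ⟨
    - B̂ l k            ∎

  B̂-alt : ∀ k → B̂ k k ≈ 0#
  B̂-alt k with pivotCase k
  ... | at-i P.refl = reflexive B̂ᵢᵢ
  ... | at-j P.refl = reflexive B̂ⱼⱼ
  ... | off-pivot k≢i k≢j = begin
    B̂ k k                                              ≡⟨ B̂-off-off k≢i k≢j k≢i k≢j ⟩
    A k k + (A k i * A j k + - (A k j * A i k)) * γ    ≈⟨ +-cong (alt k) (*-congʳ (+-cong (*-congˡ (skew j k)) (-‿cong (*-congˡ (skew i k))))) ⟩
    0# + (A k i * - A k j + - (A k j * - A k i)) * γ  ≈⟨ solve 3 (λ x y c → :0 :+ (x :* (:- y) :+ (:- (y :* (:- x)))) :* c := :0) refl (A k i) (A k j) γ ⟩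
    0#                                                 ∎

  B̂-pivot-inv : - A i j * B̂ i j ≈ 1#
  B̂-pivot-inv = trans (*-congˡ (reflexive B̂ᵢⱼ)) (trans (solve 2 (λ a c → (:- a) :* (:- c) := c :* a) refl (A i j) γ) γ-inv)

  module PivotingB̂ = Pivoting.Pivot commutativeRing B̂ B̂-skew B̂-alt i j (- A i j) B̂-pivot-inv

  -- Pivoting is an involution.
  schur-B̂ : ∀ {s t} → s ≢ i → s ≢ j → t ≢ i → t ≢ j → PivotingB̂.schur s t ≈ A s t
  schur-B̂ {s} {t} s≢i s≢j t≢i t≢j = begin
    B̂ s t + (B̂ s i * B̂ j t + - (B̂ s j * B̂ i t)) * (- A i j)
      ≡⟨ P.cong₂ (λ x y → x + y * (- A i j)) (B̂-off-off s≢i s≢j t≢i t≢j)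
           (P.cong₂ (λ x y → x + - y) (P.cong₂ _*_ (B̂-offᵢ s≢i s≢j) (B̂ⱼ-off t≢i t≢j)) (P.cong₂ _*_ (B̂-offⱼ s≢i s≢j) (B̂ᵢ-off t≢i t≢j))) ⟩
    schur s t + (- (γ * A s j) * (γ * A i t) + - ((γ * A s i) * - (γ * A j t))) * (- A i j)
      ≈⟨ solve 7 (λ st si jt sj it c a → (st :+ (si :* jt :+ (:- (sj :* it))) :* c) :+ ((:- (c :* sj)) :* (c :* it) :+ (:- ((c :* si) :* (:- (c :* jt))))) :* (:- a)
             := st :+ (c :* (si :* jt :+ (:- (sj :* it)))) :* (:1 :+ (:- (c :* a))))
           refl (A s t) (A s i) (A j t) (A s j) (A i t) γ (A i j) ⟩
    A s t + (γ * (A s i * A j t + - (A s j * A i t))) * (1# + - (γ * A i j)) ≈⟨ +-congˡ (cancel-γ _) ⟩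
    A s t + 0#  ≈⟨ +-identityʳ _ ⟩
    A s t       ∎


  -- Fuel for pf: index lists have length at most n, plus room for the two pivots.
  N : ℕ
  N = suc (suc n)

  n≤N : n ≤ N
  n≤N = ℕ.m≤n+m n 2

  -- Index sets are boolean predicates on Fin n, listed increasingly by indices.
  indices : (Fin n → Bool) → List (Fin n)
  indices b = filterᵇ b (allFin n)

  _∖_ : (Fin n → Bool) → Fin n → (Fin n → Bool)
  (b ∖ p) k = b k ∧ not (k =ᵇ p)

  indices-sorted : ∀ b → AllPairs Fin._<_ (indices b)
  indices-sorted b = AllPairs.filter⁺ (λ k → T? (b k)) (allFin-sorted n)

  ∈-indices : ∀ {b k} → b k ≡ true → k ∈ indices b
  ∈-indices {b} {k} bk = ∈-filter⁺ (λ k → T? (b k)) (∈-allFin k) (P.subst Bool.T (P.sym bk) _)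

  indices-∈ : ∀ {b k} → k ∈ indices b → b k ≡ true
  indices-∈ {b} k∈ = Bool.T-≡ .Function.Equivalence.to (proj₂ (∈-filter⁻ (λ k → T? (b k)) {xs = allFin n} k∈))

  indices-cong : ∀ {b b′ : Fin n → Bool} → (∀ k → b k ≡ b′ k) → indices b ≡ indices b′
  indices-cong b≗b′ = filterᵇ-cong-on {L = allFin n} (All.tabulate (λ {k} _ → b≗b′ k))

  delete-indices : ∀ p b → delete p (indices b) ≡ indices (b ∖ p)
  delete-indices p b = delete-filterᵇ p b (allFin n) (allFin-sorted n)

  ∖-self : ∀ b p → (b ∖ p) p ≡ false
  ∖-self b p = P.trans (P.cong (λ z → b p ∧ not z) (=ᵇ-refl p)) (Bool.∧-zeroʳ (b p))

  ∖-other : ∀ b {k p} → k ≢ p → (b ∖ p) k ≡ b k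
  ∖-other b {k} k≢p = P.trans (P.cong (λ z → b k ∧ not z) (=ᵇ-≢ k≢p)) (Bool.∧-identityʳ (b k))

  off-pivots : ∀ {b} → b i ≡ false → b j ≡ false → ∀ {k} → k ∈ indices b → (k ≢ i) × (k ≢ j)
  off-pivots {b} bi bj k∈ = (λ k≡i → absurd bi (P.subst (λ z → b z ≡ true) k≡i (indices-∈ k∈)))
                          , (λ k≡j → absurd bj (P.subst (λ z → b z ≡ true) k≡j (indices-∈ k∈)))
    where
    absurd : ∀ {x : Bool} → x ≡ false → x ≡ true → ⊥
    absurd P.refl ()

  pf-indices-off-pivots : ∀ {M M′ : Mat n n} → (∀ {k l} → k ≢ i → k ≢ j → l ≢ i → l ≢ j → M k l ≈ M′ k l) →
    ∀ {b} → b i ≡ false → b j ≡ false → ∀ fuel L → (∀ {k} → k ∈ L → k ∈ indices b) → pf M fuel L ≈ pf M′ fuel L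
  pf-indices-off-pivots M≈M′ bi bj fuel L L⊆b = pf-cong-on fuel L (λ p q p∈ q∈ →
    M≈M′ (proj₁ (off p∈)) (proj₂ (off p∈)) (proj₁ (off q∈)) (proj₂ (off q∈)))
    where
    off : ∀ {k} → k ∈ L → (k ≢ i) × (k ≢ j)
    off k∈ = off-pivots bi bj (L⊆b k∈)

  module _ (M : Mat n n) (skewM : ∀ k l → M k l ≈ - M l k) (altM : ∀ k → M k k ≈ 0#) where
    pf-indices-pull : ∀ p b → b p ≡ true → pf M N (indices b) ≈ crossingSign p (indices b) * pf M N (p ∷ indices (b ∖ p))
    pf-indices-pull p b bp = trans (pf-pull-front M skewM altM N [] p (indices b) (indices-sorted b) (∈-indices bp))
      (reflexive (P.cong (λ L → crossingSign p (indices b) * pf M N (p ∷ L)) (delete-indices p b)))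

    pf-indices-pivots : ∀ {δ} (δ-inv : δ * M i j ≈ 1#) b → b i ≡ true → b j ≡ true →
      pf M N (indices b) ≈ crossingSign i (indices b) * (crossingSign j (indices (b ∖ i)) *
        (M i j * pf (Pivoting.Pivot.schur commutativeRing M skewM altM i j δ δ-inv) (suc n) (indices ((b ∖ i) ∖ j))))
    pf-indices-pivots {δ} δ-inv b bi bj = begin
      pf M N (indices b)                                        ≈⟨ pf-indices-pull i b bi ⟩
      Dᵢ * pf M N (i ∷ indices (b ∖ i))
        ≈⟨ *-congˡ (pf-pull-front M skewM altM N [ i ] j (indices (b ∖ i)) (indices-sorted (b ∖ i)) (∈-indices (P.trans (∖-other b j≢i) bj))) ⟩
      Dᵢ * (Dⱼ * pf M N (i ∷ j ∷ delete j (indices (b ∖ i))))   ≡⟨ P.cong (λ L → Dᵢ * (Dⱼ * pf M N (i ∷ j ∷ L))) (delete-indices j (b ∖ i)) ⟩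
      Dᵢ * (Dⱼ * pf M N (i ∷ j ∷ indices ((b ∖ i) ∖ j)))
        ≈⟨ *-congˡ (*-congˡ (Pivoting.Pivot.pf-pivots-head commutativeRing M skewM altM i j _ δ-inv (suc n) (indices ((b ∖ i) ∖ j)))) ⟩
      Dᵢ * (Dⱼ * (M i j * pf schurM (suc n) (indices ((b ∖ i) ∖ j)))) ∎
      where
      schurM : Mat n n
      schurM = Pivoting.Pivot.schur commutativeRing M skewM altM i j δ δ-inv
      Dᵢ Dⱼ : Carrier
      Dᵢ = crossingSign i (indices b)
      Dⱼ = crossingSign j (indices (b ∖ i))

  pf-B̂-row-i : ∀ {b} → b i ≡ false → b j ≡ false → pf B̂ N (i ∷ indices b) ≈ - γ * pf A N (j ∷ indices b)
  pf-B̂-row-i {b} bi bj = begin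
    expand (λ y R → B̂ i y * pf B̂ (suc n) R) (indices b)
      ≈⟨ expand-cong-on (indices b) (λ y R p → *-cong
           (trans (reflexive (B̂ᵢ-off (proj₁ (off-pivots bi bj (Pick⇒∈ p))) (proj₂ (off-pivots bi bj (Pick⇒∈ p)))))
                  (solve 2 (λ c x → :- (c :* x) := (:- c) :* x) refl γ (A j y)))
           (pf-indices-off-pivots (λ a b c d → reflexive (B̂-off-off a b c d)) bi bj (suc n) R (Pick⇒⊆ p))) ⟩
    expand (λ y R → (- γ * A j y) * pf schur (suc n) R) (indices b)
      ≈⟨ trans (expand-cong (indices b) (λ y R → *-assoc _ _ _)) (expand-* (- γ) _ (indices b)) ⟩
    - γ * expand (λ y R → A j y * pf schur (suc n) R) (indices b) ≈⟨ *-congˡ (pf-pivotⱼ-head (suc n) (indices b)) ⟨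
    - γ * pf A N (j ∷ indices b)                                  ∎

  pf-B̂-row-j : ∀ {b} → b i ≡ false → b j ≡ false → pf B̂ N (j ∷ indices b) ≈ γ * pf A N (i ∷ indices b)
  pf-B̂-row-j {b} bi bj = begin
    expand (λ y R → B̂ j y * pf B̂ (suc n) R) (indices b)
      ≈⟨ expand-cong-on (indices b) (λ y R p → *-cong
           (reflexive (B̂ⱼ-off (proj₁ (off-pivots bi bj (Pick⇒∈ p))) (proj₂ (off-pivots bi bj (Pick⇒∈ p)))))
           (pf-indices-off-pivots (λ a b c d → reflexive (B̂-off-off a b c d)) bi bj (suc n) R (Pick⇒⊆ p))) ⟩
    expand (λ y R → (γ * A i y) * pf schur (suc n) R) (indices b)
      ≈⟨ trans (expand-cong (indices b) (λ y R → *-assoc _ _ _)) (expand-* γ _ (indices b)) ⟩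
    γ * expand (λ y R → A i y * pf schur (suc n) R) (indices b) ≈⟨ *-congˡ (pf-pivotᵢ-head (suc n) (indices b)) ⟨
    γ * pf A N (i ∷ indices b)                                  ∎

  onlyIf : Bool → Carrier → Carrier
  onlyIf b x = if b then x else 1#

  prodL-indices³ : ∀ (b₁ b₂ b₃ : Fin n → Bool) (w₁ w₂ w₃ : Fin n → Carrier) →
    prodL w₁ (indices b₁) * (prodL w₂ (indices b₂) * prodL w₃ (indices b₃)) ≈
    prodL (λ k → onlyIf (b₁ k) (w₁ k) * (onlyIf (b₂ k) (w₂ k) * onlyIf (b₃ k) (w₃ k))) (allFin n)
  prodL-indices³ b₁ b₂ b₃ w₁ w₂ w₃ = begin
    prodL w₁ (indices b₁) * (prodL w₂ (indices b₂) * prodL w₃ (indices b₃))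
      ≈⟨ *-cong (prodL-filterᵇ w₁ b₁ (allFin n)) (*-cong (prodL-filterᵇ w₂ b₂ (allFin n)) (prodL-filterᵇ w₃ b₃ (allFin n))) ⟩
    prodL f₁ (allFin n) * (prodL f₂ (allFin n) * prodL f₃ (allFin n)) ≈⟨ *-congˡ (prodL-* f₂ f₃ (allFin n)) ⟨
    prodL f₁ (allFin n) * prodL (λ k → f₂ k * f₃ k) (allFin n)         ≈⟨ prodL-* f₁ (λ k → f₂ k * f₃ k) (allFin n) ⟨
    prodL (λ k → f₁ k * (f₂ k * f₃ k)) (allFin n)                      ∎
    where
    f₁ f₂ f₃ : Fin n → Carrier
    f₁ k = onlyIf (b₁ k) (w₁ k)
    f₂ k = onlyIf (b₂ k) (w₂ k)
    f₃ k = onlyIf (b₃ k) (w₃ k)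

  onlyIf³-cong : ∀ {b₁ b₂ b₃ b₁′ b₂′ b₃′} {x y z : Carrier} → b₁ ≡ b₁′ → b₂ ≡ b₂′ → b₃ ≡ b₃′ →
    onlyIf b₁ x * (onlyIf b₂ y * onlyIf b₃ z) ≡ onlyIf b₁′ x * (onlyIf b₂′ y * onlyIf b₃′ z)
  onlyIf³-cong P.refl P.refl P.refl = P.refl

  flipSign-sideSigns : ∀ b k → onlyIf b (flipSign i j k) * (onlyIf b (sideSign i k) * onlyIf b (sideSign j k)) ≈ 1#
  flipSign-sideSigns false k = trans (*-identityˡ _) (*-identityˡ _)
  flipSign-sideSigns true  k = begin
    flipSign i j k * (sideSign i k * sideSign j k)               ≈⟨ *-congʳ (flipSign≈sideSigns i j i<j k) ⟩
    (sideSign i k * sideSign j k) * (sideSign i k * sideSign j k) ≈⟨ solve 2 (λ a b → (a :* b) :* (a :* b) := (a :* a) :* (b :* b)) refl _ _ ⟩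
    (sideSign i k * sideSign i k) * (sideSign j k * sideSign j k) ≈⟨ *-cong (sideSign² i k) (sideSign² j k) ⟩
    1# * 1#                                                       ≈⟨ *-identityˡ 1# ⟩
    1#                                                            ∎

  flipSign-i : flipSign i j i ≈ - 1#
  flipSign-i = trans (flipSign≈sideSigns i j i<j i) (trans (reflexive (P.cong₂ _*_ (sideSign-self i) (sideSign-below i<j))) (*-identityˡ _))

  flipSign-j : flipSign i j j ≈ 1#
  flipSign-j = trans (flipSign≈sideSigns i j i<j j) (trans (reflexive (P.cong₂ _*_ (sideSign-above i<j) (sideSign-self j))) (*-identityˡ _))

  prodL-allFin-at-i : ∀ {w : Fin n → Carrier} → (∀ k → w k ≈ (if k =ᵇ i then - 1# else 1#)) → prodL w (allFin n) ≈ - 1#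
  prodL-allFin-at-i w≈ = trans (prodL-cong (allFin n) w≈) (prodL-δ i (- 1#) (allFin n) (allFin-sorted n) (∈-allFin i))

  transfer-sign : ∀ {p q σ} w → p * q ≈ σ → q * q ≈ 1# → p * w ≈ σ * (q * w)
  transfer-sign {p} {q} {σ} w pq≈σ q²≈1 = begin
    p * w                                    ≈⟨ solve 3 (λ p q w → p :* w := (p :* q) :* (q :* w) :+ (p :* w) :* (:1 :+ (:- (q :* q)))) refl p q w ⟩
    (p * q) * (q * w) + (p * w) * (1# + - (q * q)) ≈⟨ +-cong (*-congʳ pq≈σ) (*-congˡ (+-congˡ (-‿cong q²≈1))) ⟩
    σ * (q * w) + (p * w) * (1# + - 1#)      ≈⟨ solve 2 (λ a b → a :+ b :* (:1 :+ (:- :1)) := a) refl (σ * (q * w)) (p * w) ⟩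
    σ * (q * w)                              ∎

  *-square-one : ∀ {a b} → a * a ≈ 1# → b * b ≈ 1# → (a * b) * (a * b) ≈ 1#
  *-square-one {a} {b} a²≈1 b²≈1 = trans (solve 2 (λ a b → (a :* b) :* (a :* b) := (a :* a) :* (b :* b)) refl a b) (trans (*-cong a²≈1 b²≈1) (*-identityˡ 1#))

  pf-fuel-indices : ∀ (M : Mat n n) b → pf M N (indices b) ≈ pf M (suc n) (indices b)
  pf-fuel-indices M b = pf-fuel M N (suc n) (indices b) (ℕ.≤-trans (length-filterᵇ-allFin b) n≤N) (ℕ.≤-trans (length-filterᵇ-allFin b) (ℕ.n≤1+n n))

  module _ (S : Subset n) where
    inS inSΔ : Fin n → Bool
    inS k  = Vec.lookup S k
    inSΔ k = Vec.lookup (S Δ pair i j) k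

    private
      inSΔ-xor : ∀ k → inSΔ k ≡ inS k xor isPivot k
      inSΔ-xor k = P.trans (Vec.lookup-zipWith _xor_ k S (pair i j)) (P.cong (inS k xor_) (Vec.lookup∘tabulate _ k))

    inSΔ-i : inSΔ i ≡ not (inS i)
    inSΔ-i = P.trans (inSΔ-xor i) (P.trans (P.cong (inS i xor_) isPivot-i) (Bool.xor-comm (inS i) true))

    inSΔ-j : inSΔ j ≡ not (inS j)
    inSΔ-j = P.trans (inSΔ-xor j) (P.trans (P.cong (inS j xor_) isPivot-j) (Bool.xor-comm (inS j) true))

    inSΔ-off : ∀ {k} → k ≢ i → k ≢ j → inSΔ k ≡ inS k
    inSΔ-off {k} k≢i k≢j = P.trans (inSΔ-xor k) (P.trans (P.cong (inS k xor_) (isPivot-off k≢i k≢j)) (Bool.xor-identityʳ (inS k)))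

    es : List (Fin n)
    es = indices inS

    inSΔ-i-flip : ∀ {b} → inS i ≡ b → inSΔ i ≡ not b
    inSΔ-i-flip i∈?S = P.trans inSΔ-i (P.cong not i∈?S)

    inSΔ-j-flip : ∀ {b} → inS j ≡ b → inSΔ j ≡ not b
    inSΔ-j-flip j∈?S = P.trans inSΔ-j (P.cong not j∈?S)

    sign-both-outside : inS i ≡ false → inS j ≡ false →
      prodL (flipSign i j) es * (crossingSign i (indices inSΔ) * crossingSign j (indices (inSΔ ∖ i))) ≈ 1#
    sign-both-outside i∉S j∉S = trans (prodL-indices³ inS inSΔ (inSΔ ∖ i) (flipSign i j) (sideSign i) (sideSign j))
      (prodL-1 {L = allFin n} (All.tabulate (λ {k} _ → at k)))
      where
      at : ∀ k → onlyIf (inS k) (flipSign i j k) * (onlyIf (inSΔ k) (sideSign i k) * onlyIf ((inSΔ ∖ i) k) (sideSign j k)) ≈ 1#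
      at k with pivotCase k
      ... | at-i P.refl = trans (reflexive (onlyIf³-cong i∉S (inSΔ-i-flip i∉S) (∖-self inSΔ i)))
        (trans (*-identityˡ _) (trans (*-identityʳ _) (reflexive (sideSign-self i))))
      ... | at-j P.refl = trans (reflexive (onlyIf³-cong j∉S (inSΔ-j-flip j∉S) (P.trans (∖-other inSΔ j≢i) (inSΔ-j-flip j∉S))))
        (trans (*-identityˡ _) (trans (reflexive (P.cong₂ _*_ (sideSign-above i<j) (sideSign-self j))) (*-identityˡ 1#)))
      ... | off-pivot k≢i k≢j = trans (reflexive (onlyIf³-cong {b₁′ = inS k} P.refl (inSΔ-off k≢i k≢j) (P.trans (∖-other inSΔ k≢i) (inSΔ-off k≢i k≢j))))
        (flipSign-sideSigns (inS k) k)

    sign-both-inside : inS i ≡ true → inS j ≡ true →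
      prodL (flipSign i j) es * (crossingSign i es * crossingSign j (indices (inS ∖ i))) ≈ - 1#
    sign-both-inside i∈S j∈S = trans (prodL-indices³ inS inS (inS ∖ i) (flipSign i j) (sideSign i) (sideSign j)) (prodL-allFin-at-i at)
      where
      at : ∀ k → onlyIf (inS k) (flipSign i j k) * (onlyIf (inS k) (sideSign i k) * onlyIf ((inS ∖ i) k) (sideSign j k)) ≈ (if k =ᵇ i then - 1# else 1#)
      at k with pivotCase k
      ... | at-i P.refl = trans (reflexive (onlyIf³-cong i∈S i∈S (∖-self inS i)))
        (trans (*-cong flipSign-i (trans (*-identityʳ _) (reflexive (sideSign-self i)))) (trans (*-identityʳ _) (reflexive (P.sym (if-true (=ᵇ-refl i))))))
      ... | at-j P.refl = trans (reflexive (onlyIf³-cong j∈S j∈S (P.trans (∖-other inS j≢i) j∈S)))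
        (trans (*-cong flipSign-j (trans (reflexive (P.cong₂ _*_ (sideSign-above i<j) (sideSign-self j))) (*-identityˡ 1#)))
               (trans (*-identityˡ 1#) (reflexive (P.sym (if-false (=ᵇ-≢ j≢i))))))
      ... | off-pivot k≢i k≢j = trans (reflexive (onlyIf³-cong {b₁′ = inS k} {b₂′ = inS k} P.refl P.refl (∖-other inS k≢i)))
        (trans (flipSign-sideSigns (inS k) k) (reflexive (P.sym (if-false (=ᵇ-≢ k≢i)))))

    sign-only-i-inside : inS i ≡ true → inS j ≡ false →
      prodL (flipSign i j) es * (crossingSign i es * crossingSign j (indices inSΔ)) ≈ - 1#
    sign-only-i-inside i∈S j∉S = trans (prodL-indices³ inS inS inSΔ (flipSign i j) (sideSign i) (sideSign j)) (prodL-allFin-at-i at)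
      where
      at : ∀ k → onlyIf (inS k) (flipSign i j k) * (onlyIf (inS k) (sideSign i k) * onlyIf (inSΔ k) (sideSign j k)) ≈ (if k =ᵇ i then - 1# else 1#)
      at k with pivotCase k
      ... | at-i P.refl = trans (reflexive (onlyIf³-cong i∈S i∈S (inSΔ-i-flip i∈S)))
        (trans (*-cong flipSign-i (trans (*-identityʳ _) (reflexive (sideSign-self i)))) (trans (*-identityʳ _) (reflexive (P.sym (if-true (=ᵇ-refl i))))))
      ... | at-j P.refl = trans (reflexive (onlyIf³-cong j∉S j∉S (inSΔ-j-flip j∉S)))
        (trans (*-identityˡ _) (trans (*-identityˡ _) (trans (reflexive (sideSign-self j)) (reflexive (P.sym (if-false (=ᵇ-≢ j≢i)))))))
      ... | off-pivot k≢i k≢j = trans (reflexive (onlyIf³-cong {b₁′ = inS k} {b₂′ = inS k} P.refl P.refl (inSΔ-off k≢i k≢j)))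
        (trans (flipSign-sideSigns (inS k) k) (reflexive (P.sym (if-false (=ᵇ-≢ k≢i)))))

    sign-only-j-inside : inS i ≡ false → inS j ≡ true →
      prodL (flipSign i j) es * (crossingSign j es * crossingSign i (indices inSΔ)) ≈ 1#
    sign-only-j-inside i∉S j∈S = trans (prodL-indices³ inS inS inSΔ (flipSign i j) (sideSign j) (sideSign i))
      (prodL-1 {L = allFin n} (All.tabulate (λ {k} _ → at k)))
      where
      at : ∀ k → onlyIf (inS k) (flipSign i j k) * (onlyIf (inS k) (sideSign j k) * onlyIf (inSΔ k) (sideSign i k)) ≈ 1#
      at k with pivotCase k
      ... | at-i P.refl = trans (reflexive (onlyIf³-cong i∉S i∉S (inSΔ-i-flip i∉S))) (trans (*-identityˡ _) (trans (*-identityˡ _) (reflexive (sideSign-self i))))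
      ... | at-j P.refl = trans (reflexive (onlyIf³-cong j∈S j∈S (inSΔ-j-flip j∈S)))
        (trans (*-cong flipSign-j (trans (*-identityʳ _) (reflexive (sideSign-self j)))) (*-identityˡ 1#))
      ... | off-pivot k≢i k≢j = trans (reflexive (onlyIf³-cong {b₁′ = inS k} {b₂′ = inS k} P.refl P.refl (inSΔ-off k≢i k≢j)))
        (trans (*-congˡ (*-comm _ _)) (flipSign-sideSigns (inS k) k))

    both-outside : inS i ≡ false → inS j ≡ false → prodL (flipSign i j) es * pf B̂ N es ≈ pf A N (indices inSΔ) * γ
    both-outside i∉S j∉S = begin
      Pd * pf B̂ N es        ≈⟨ *-congˡ B̂-side ⟩
      Pd * X                ≈⟨ transfer-sign X (sign-both-outside i∉S j∉S) (*-square-one (crossingSign² i (indices inSΔ)) (crossingSign² j (indices T))) ⟩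
      1# * ((Dᵢ * Dⱼ) * X)
        ≈⟨ solve 5 (λ a b x c q → :1 :* ((a :* b) :* x) := (a :* (b :* (q :* x))) :* c :+ ((a :* b) :* x) :* (:1 :+ (:- (c :* q)))) refl Dᵢ Dⱼ X γ (A i j) ⟩
      (Dᵢ * (Dⱼ * (A i j * X))) * γ + ((Dᵢ * Dⱼ) * X) * (1# + - (γ * A i j)) ≈⟨ +-congˡ (cancel-γ _) ⟩
      (Dᵢ * (Dⱼ * (A i j * X))) * γ + 0#   ≈⟨ +-identityʳ _ ⟩
      (Dᵢ * (Dⱼ * (A i j * X))) * γ        ≈⟨ *-congʳ A-side ⟨
      pf A N (indices inSΔ) * γ            ∎
      where
      T : Fin n → Bool
      T = inSΔ ∖ i
      Pd Dᵢ Dⱼ X : Carrier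
      Pd = prodL (flipSign i j) es
      Dᵢ = crossingSign i (indices inSΔ)
      Dⱼ = crossingSign j (indices T)
      X = pf schur (suc n) es
      T∖j≗S : ∀ k → (T ∖ j) k ≡ inS k
      T∖j≗S k with pivotCase k
      ... | at-i P.refl = P.trans (P.cong (λ z → z ∧ not (i =ᵇ j)) (∖-self inSΔ i)) (P.sym i∉S)
      ... | at-j P.refl = P.trans (∖-self T j) (P.sym j∉S)
      ... | off-pivot k≢i k≢j = P.trans (∖-other T k≢j) (P.trans (∖-other inSΔ k≢i) (inSΔ-off k≢i k≢j))
      B̂-side : pf B̂ N es ≈ X
      B̂-side = trans (pf-indices-off-pivots (λ a b c d → reflexive (B̂-off-off a b c d)) i∉S j∉S N es (λ k∈ → k∈)) (pf-fuel-indices schur inS)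
      A-side : pf A N (indices inSΔ) ≈ Dᵢ * (Dⱼ * (A i j * X))
      A-side = trans (pf-indices-pivots A skew alt γ-inv inSΔ (inSΔ-i-flip i∉S) (inSΔ-j-flip j∉S))
        (reflexive (P.cong (λ L → Dᵢ * (Dⱼ * (A i j * pf schur (suc n) L))) (indices-cong T∖j≗S)))

    both-inside : inS i ≡ true → inS j ≡ true → prodL (flipSign i j) es * pf B̂ N es ≈ pf A N (indices inSΔ) * γ
    both-inside i∈S j∈S = begin
      Pd * pf B̂ N es                ≈⟨ *-congˡ B̂-side ⟩
      Pd * (Dᵢ * (Dⱼ * (- γ * Y)))  ≈⟨ solve 4 (λ p a b w → p :* (a :* (b :* w)) := (p :* (a :* b)) :* w) refl Pd Dᵢ Dⱼ (- γ * Y) ⟩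
      (Pd * (Dᵢ * Dⱼ)) * (- γ * Y)  ≈⟨ *-congʳ (sign-both-inside i∈S j∈S) ⟩
      - 1# * (- γ * Y)              ≈⟨ solve 2 (λ c y → (:- :1) :* ((:- c) :* y) := y :* c) refl γ Y ⟩
      Y * γ                         ∎
      where
      T : Fin n → Bool
      T = inS ∖ i
      Pd Dᵢ Dⱼ Y : Carrier
      Pd = prodL (flipSign i j) es
      Dᵢ = crossingSign i es
      Dⱼ = crossingSign j (indices T)
      Y = pf A N (indices inSΔ)
      i∉SΔ : inSΔ i ≡ false
      i∉SΔ = inSΔ-i-flip i∈S
      j∉SΔ : inSΔ j ≡ false
      j∉SΔ = inSΔ-j-flip j∈S
      T∖j≗SΔ : ∀ k → (T ∖ j) k ≡ inSΔ k
      T∖j≗SΔ k with pivotCase k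
      ... | at-i P.refl = P.trans (P.cong (λ z → z ∧ not (i =ᵇ j)) (∖-self inS i)) (P.sym i∉SΔ)
      ... | at-j P.refl = P.trans (∖-self T j) (P.sym j∉SΔ)
      ... | off-pivot k≢i k≢j = P.trans (∖-other T k≢j) (P.trans (∖-other inS k≢i) (P.sym (inSΔ-off k≢i k≢j)))
      B̂-side : pf B̂ N es ≈ Dᵢ * (Dⱼ * (- γ * Y))
      B̂-side = begin
        pf B̂ N es                                                      ≈⟨ pf-indices-pivots B̂ B̂-skew B̂-alt B̂-pivot-inv inS i∈S j∈S ⟩
        Dᵢ * (Dⱼ * (B̂ i j * pf PivotingB̂.schur (suc n) (indices (T ∖ j))))
          ≡⟨ P.cong (λ L → Dᵢ * (Dⱼ * (B̂ i j * pf PivotingB̂.schur (suc n) L))) (indices-cong T∖j≗SΔ) ⟩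
        Dᵢ * (Dⱼ * (B̂ i j * pf PivotingB̂.schur (suc n) (indices inSΔ)))
          ≈⟨ *-congˡ (*-congˡ (*-cong (reflexive B̂ᵢⱼ) (pf-indices-off-pivots schur-B̂ i∉SΔ j∉SΔ (suc n) (indices inSΔ) (λ k∈ → k∈)))) ⟩
        Dᵢ * (Dⱼ * (- γ * pf A (suc n) (indices inSΔ)))                ≈⟨ *-congˡ (*-congˡ (*-congˡ (pf-fuel-indices A inSΔ))) ⟨
        Dᵢ * (Dⱼ * (- γ * Y))                                          ∎

    only-i-inside : inS i ≡ true → inS j ≡ false → prodL (flipSign i j) es * pf B̂ N es ≈ pf A N (indices inSΔ) * γ
    only-i-inside i∈S j∉S = begin
      Pd * pf B̂ N es           ≈⟨ *-congˡ B̂-side ⟩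
      Pd * (Dᵢ * (- γ * Z))    ≈⟨ *-assoc _ _ _ ⟨
      (Pd * Dᵢ) * (- γ * Z)    ≈⟨ transfer-sign (- γ * Z) (trans (*-assoc _ _ _) (sign-only-i-inside i∈S j∉S)) (crossingSign² j (indices inSΔ)) ⟩
      - 1# * (Dⱼ * (- γ * Z))  ≈⟨ solve 3 (λ b c z → (:- :1) :* (b :* ((:- c) :* z)) := (b :* z) :* c) refl Dⱼ γ Z ⟩
      (Dⱼ * Z) * γ             ≈⟨ *-congʳ A-side ⟨
      pf A N (indices inSΔ) * γ ∎
      where
      T U : Fin n → Bool
      T = inS ∖ i
      U = inSΔ ∖ j
      Pd Dᵢ Dⱼ Z : Carrier
      Pd = prodL (flipSign i j) es
      Dᵢ = crossingSign i es
      Dⱼ = crossingSign j (indices inSΔ)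
      Z = pf A N (j ∷ indices T)
      i∉SΔ : inSΔ i ≡ false
      i∉SΔ = inSΔ-i-flip i∈S
      j∈SΔ : inSΔ j ≡ true
      j∈SΔ = inSΔ-j-flip j∉S
      i∉T : T i ≡ false
      i∉T = ∖-self inS i
      j∉T : T j ≡ false
      j∉T = P.trans (∖-other inS j≢i) j∉S
      U≗T : ∀ k → U k ≡ T k
      U≗T k with pivotCase k
      ... | at-i P.refl = P.trans (P.cong (λ z → z ∧ not (i =ᵇ j)) i∉SΔ) (P.sym i∉T)
      ... | at-j P.refl = P.trans (∖-self inSΔ j) (P.sym j∉T)
      ... | off-pivot k≢i k≢j = P.trans (∖-other inSΔ k≢j) (P.trans (inSΔ-off k≢i k≢j) (P.sym (∖-other inS k≢i)))
      B̂-side : pf B̂ N es ≈ Dᵢ * (- γ * Z)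
      B̂-side = trans (pf-indices-pull B̂ B̂-skew B̂-alt i inS i∈S) (*-congˡ (pf-B̂-row-i i∉T j∉T))
      A-side : pf A N (indices inSΔ) ≈ Dⱼ * Z
      A-side = trans (pf-indices-pull A skew alt j inSΔ j∈SΔ) (reflexive (P.cong (λ L → Dⱼ * pf A N (j ∷ L)) (indices-cong U≗T)))

    only-j-inside : inS i ≡ false → inS j ≡ true → prodL (flipSign i j) es * pf B̂ N es ≈ pf A N (indices inSΔ) * γ
    only-j-inside i∉S j∈S = begin
      Pd * pf B̂ N es         ≈⟨ *-congˡ B̂-side ⟩
      Pd * (Dⱼ * (γ * Z))    ≈⟨ *-assoc _ _ _ ⟨
      (Pd * Dⱼ) * (γ * Z)    ≈⟨ transfer-sign (γ * Z) (trans (*-assoc _ _ _) (sign-only-j-inside i∉S j∈S)) (crossingSign² i (indices inSΔ)) ⟩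
      1# * (Dᵢ * (γ * Z))    ≈⟨ solve 3 (λ b c z → :1 :* (b :* (c :* z)) := (b :* z) :* c) refl Dᵢ γ Z ⟩
      (Dᵢ * Z) * γ           ≈⟨ *-congʳ A-side ⟨
      pf A N (indices inSΔ) * γ ∎
      where
      T U : Fin n → Bool
      T = inS ∖ j
      U = inSΔ ∖ i
      Pd Dᵢ Dⱼ Z : Carrier
      Pd = prodL (flipSign i j) es
      Dⱼ = crossingSign j es
      Dᵢ = crossingSign i (indices inSΔ)
      Z = pf A N (i ∷ indices T)
      i∈SΔ : inSΔ i ≡ true
      i∈SΔ = inSΔ-i-flip i∉S
      j∉SΔ : inSΔ j ≡ false
      j∉SΔ = inSΔ-j-flip j∈S
      i∉T : T i ≡ false
      i∉T = P.trans (∖-other inS i≢j) i∉S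
      j∉T : T j ≡ false
      j∉T = ∖-self inS j
      U≗T : ∀ k → U k ≡ T k
      U≗T k with pivotCase k
      ... | at-i P.refl = P.trans (∖-self inSΔ i) (P.sym i∉T)
      ... | at-j P.refl = P.trans (P.cong (λ z → z ∧ not (j =ᵇ i)) j∉SΔ) (P.sym j∉T)
      ... | off-pivot k≢i k≢j = P.trans (∖-other inSΔ k≢i) (P.trans (inSΔ-off k≢i k≢j) (P.sym (∖-other inS k≢j)))
      B̂-side : pf B̂ N es ≈ Dⱼ * (γ * Z)
      B̂-side = trans (pf-indices-pull B̂ B̂-skew B̂-alt j inS j∈S) (*-congˡ (pf-B̂-row-j i∉T j∉T))
      A-side : pf A N (indices inSΔ) ≈ Dᵢ * Z
      A-side = trans (pf-indices-pull A skew alt i inSΔ i∈SΔ) (reflexive (P.cong (λ L → Dᵢ * pf A N (i ∷ L)) (indices-cong U≗T)))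

    pivot-identity : prodL (flipSign i j) es * pf B̂ N es ≈ pf A N (indices inSΔ) * γ
    pivot-identity with inS i in i∈? | inS j in j∈?
    ... | false | false = both-outside i∈? j∈?
    ... | false | true  = only-j-inside i∈? j∈?
    ... | true  | false = only-i-inside i∈? j∈?
    ... | true  | true  = both-inside i∈? j∈?

mainTheorem3 : ∀ {c ℓ} (F : Field c ℓ) →
    let open Field F
        open WithField F
    in (n : ℕ) (A : Mat n n) → SkewSymmetric A →
       (i j : Fin n) → i < j → (nz : ¬ (A i j ≈ 0#)) →
       (E B : Mat n n) → Invertible E →
       (E ⊗ swapped A i j) ≈ₘ augment B I →
       (S : Subset n) →
       PfSub (flipRC i j B) S ≈ PfSub A (S Δ pair i j) * inv (A i j) nz
mainTheorem3 F n A skA i j i<j nz E B invE reduces S = begin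
  PfSub (flipRC i j B) S                             ≈⟨ PfSub≈pf (flipRC i j B) S N n≤N ⟩
  pf (flipRC i j B) N (elems S)                      ≈⟨ pf-scale (flipSign i j) B N (elems S) ⟩
  prodL (flipSign i j) (elems S) * pf B N (elems S)  ≈⟨ *-congˡ (pf-cong N (elems S) B≈B̂) ⟩
  prodL (flipSign i j) (elems S) * pf B̂ N (elems S)  ≈⟨ pivot-identity S ⟩
  pf A N (elems (S Δ pair i j)) * γ                  ≈⟨ *-congʳ (PfSub≈pf A (S Δ pair i j) N n≤N) ⟨
  PfSub A (S Δ pair i j) * inv (A i j) nz            ∎
  where
  open Field F
  open WithField F
  open Expansion commutativeRing using (pf; pf-cong)
  open PermutationSums F using (PfSub≈pf)
  open Signs.Products commutativeRing using (prodL; pf-scale)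
  open PivotedMatrix F n A skA i j i<j nz E B invE reduces
  open import Relation.Binary.Reasoning.Setoid setoid
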